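{- Let $p$ and $q$ be primes with $p<q$ and let $G$ be a cyclic group of order $pq$. Then \[ M_1(\mathcal{B}(G))=p^4q^4-2p^4q^2-2p^2q^4+5p^2q^2+2p^4+2q^4-4p^2-4q^2+4, \] \[ M_2(\mathcal{B}(G))=p^4q^4-2p^4q^2-2p^2q^4+4p^2q^2+2p^4+2q^4-4p^2-4q^2+4, \] and \[ \frac{M_{2}(\mathcal{B}(G))}{\vert e(\mathcal{B}(G))\vert} > \frac{M_{1}(\mathcal{B}(G))}{\vert V(\mathcal{B}(G)) \vert}. \]
   Context: For a finite group $G$, let $L(G)$ be the set of all subgroups of $G$. The SGB-graph $\mathcal{B}(G)$ is the bipartite graph with vertex set $V(\mathcal{B}(G))=(G\times G)\sqcup L(G)$, in which $(a,b)\in G\times G$ is adjacent to $H\in L(G)$ if and only if $H=\langle a,b\rangle$; there are no other edges. For a simple graph $\mathcal{G}$ with vertex set $V(\mathcal{G})$ and edge set $e(\mathcal{G})$, the first and second Zagreb indices are $M_1(\mathcal{G})=\sum_{v\in V(\mathcal{G})}\deg(v)^2$ and $M_2(\mathcal{G})=\sum_{uv\in e(\mathcal{G})}\deg(u)\deg(v)$. -}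

module Defs where

open import Data.Nat using (ℕ; zero; suc; _+_; _*_; _^_)
open import Data.Bool using (Bool; true; false; _∧_; _∨_; not; if_then_else_)
open import Data.Fin using (Fin)
open import Data.Vec using (Vec; []; _∷_; lookup)
open import Data.List using (List; []; _∷_; map; length; allFin; cartesianProduct; _++_; filter)
open import Data.Nat.ListAction using (sum)
open import Data.Bool.ListAction using (all)
open import Data.Product using (Σ; ∃; _×_; _,_)
open import Relation.Binary.PropositionalEquality using (_≡_)
open import Relation.Nullary using (Dec)
open import Data.Bool using (T; T?)

-- A finite set of size n is identified with Fin n; a finite group of order n
-- is any group structure (with propositional equality) on Fin n.  Every finite
-- group of order n is isomorphic to such a structure.

Subset : ℕ → Set
Subset n = Vec Bool n

allSubsets : (n : ℕ) → List (Subset n)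
allSubsets zero = [] ∷ []
allSubsets (suc n) = map (true ∷_) (allSubsets n) ++ map (false ∷_) (allSubsets n)

_⇒ᵇ_ : Bool → Bool → Bool
a ⇒ᵇ b = not a ∨ b

count : {A : Set} → (A → Bool) → List A → ℕ
count f xs = sum (map (λ x → if f x then 1 else 0) xs)

pow : {n : ℕ} → (Fin n → Fin n → Fin n) → Fin n → Fin n → ℕ → Fin n
pow _∙_ e g zero = e
pow _∙_ e g (suc k) = g ∙ pow _∙_ e g k

IsCyclic : {n : ℕ} → (Fin n → Fin n → Fin n) → Fin n → Set
IsCyclic {n} _∙_ e = Σ (Fin n) λ g → (x : Fin n) → Σ ℕ λ k → x ≡ pow _∙_ e g k

module SGB {n : ℕ} (_∙_ : Fin n → Fin n → Fin n) (e : Fin n) (inv : Fin n → Fin n) where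

  elems : List (Fin n)
  elems = allFin n

  _∈ᵇ_ : Fin n → Subset n → Bool
  x ∈ᵇ S = lookup S x

  isSubgroup : Subset n → Bool
  isSubgroup S = (e ∈ᵇ S)
    ∧ all (λ x → all (λ y → ((x ∈ᵇ S) ∧ (y ∈ᵇ S)) ⇒ᵇ ((x ∙ y) ∈ᵇ S)) elems) elems
    ∧ all (λ x → (x ∈ᵇ S) ⇒ᵇ (inv x ∈ᵇ S)) elems

  _⊆ᵇ_ : Subset n → Subset n → Bool
  S ⊆ᵇ K = all (λ x → (x ∈ᵇ S) ⇒ᵇ (x ∈ᵇ K)) elems

  L : List (Subset n)
  L = filter (λ S → T? (isSubgroup S)) (allSubsets n)

  generates : Fin n × Fin n → Subset n → Bool
  generates (a , b) H = isSubgroup H ∧ (a ∈ᵇ H) ∧ (b ∈ᵇ H)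
    ∧ all (λ K → (isSubgroup K ∧ (a ∈ᵇ K) ∧ (b ∈ᵇ K)) ⇒ᵇ (H ⊆ᵇ K)) (allSubsets n)

  pairs : List (Fin n × Fin n)
  pairs = cartesianProduct elems elems

  -- vertices of B(G): pairs ⊔ L(G); edges: (ab , H) with H = ⟨a,b⟩
  degPair : Fin n × Fin n → ℕ
  degPair ab = count (generates ab) L

  degSub : Subset n → ℕ
  degSub H = count (λ ab → generates ab H) pairs

  numVertices : ℕ
  numVertices = length pairs + length L

  numEdges : ℕ
  numEdges = sum (map (λ H → count (λ ab → generates ab H) pairs) L)

  M₁ : ℕ
  M₁ = sum (map (λ ab → degPair ab ^ 2) pairs) + sum (map (λ H → degSub H ^ 2) L)

  M₂ : ℕ
  M₂ = sum (map (λ H → sum (map (λ ab → if generates ab H then degPair ab * degSub H else 0) pairs)) L)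

module Submission where

-- Let log : G → {0, …, pq − 1} be the discrete logarithm of the cyclic group G of order pq. The
-- subgroups of G are the four sets {x ∣ d ∣ log x} with d ∣ pq; Bézout shows that there are no others.
-- In any finite group a pair (a , b) is adjacent only to ⟨a , b⟩, and that subgroup lies in K exactly
-- when a, b ∈ K, so Σ_{H ≤ K} deg H = |K|². Over the subgroups of orders 1, p, q and pq this forces
-- the degrees 1, p² − 1, q² − 1 and (p² − 1)(q² − 1). With N = p²q² and S = Σ_H (deg H)² one gets
-- M₁ = N + S, M₂ = S, |e| = N and |V| = N + 4, so the inequality reduces to N² < 4S, which holds
-- because N ≤ 2 (p² − 1)(q² − 1).

open import Data.Nat using (ℕ)
import Data.Nat as ℕ
open import Data.Fin using (Fin)
open import Data.Product using (∃)
open import Relation.Binary.PropositionalEquality using (_≡_; _≢_)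
open import Algebra.Structures using (IsGroup)
open import Data.Nat.Primality using (Prime)
open import Defs

module Booleans where

  open import Data.Bool using (Bool; true; false; T; _∨_)
  open import Data.Bool.ListAction using (all)
  open import Data.List using (List)
  open import Data.List.Membership.Propositional using (_∈_)
  open import Data.List.Relation.Unary.All as All using ()
  open import Data.List.Relation.Unary.All.Properties using (all⁺; all⁻)
  open import Data.Unit using (tt)
  open import Function using (_⇔_; mk⇔)
  open import Relation.Binary.PropositionalEquality using (_≡_; refl)
  open import Relation.Nullary.Decidable using (Dec; yes; no; does)

  private
    variable
      A : Set

  T-⇒ᵇ : ∀ {a b} → T (a ⇒ᵇ b) ⇔ (T a → T b)
  T-⇒ᵇ {false} = mk⇔ (λ _ ()) (λ _ → tt)
  T-⇒ᵇ {true}  = mk⇔ (λ t _ → t) (λ f → f tt)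

  T-all : ∀ {f : A → Bool} {xs : List A} → T (all f xs) ⇔ (∀ x → x ∈ xs → T (f x))
  T-all {f = f} {xs} = mk⇔ (λ t x → All.lookup (all⁺ f xs t)) (λ h → all⁻ f (All.tabulate (h _)))

  T-injective : ∀ {a b} → (T a → T b) → (T b → T a) → a ≡ b
  T-injective {false} {false} _ _ = refl
  T-injective {false} {true}  _ g with () ← g tt
  T-injective {true}  {false} f _ with () ← f tt
  T-injective {true}  {true}  _ _ = refl

  T-does : ∀ {P : Set} (P? : Dec P) → T (does P?) ⇔ P
  T-does (yes p) = mk⇔ (λ _ → p) (λ _ → tt)
  T-does (no ¬p) = mk⇔ (λ ()) ¬p

  ⇒ᵇ-refl : ∀ a → T (a ⇒ᵇ a)
  ⇒ᵇ-refl false = tt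
  ⇒ᵇ-refl true  = tt

  ⇒ᵇ-antisym : ∀ {a b} → T (a ⇒ᵇ b) → T (b ⇒ᵇ a) → a ≡ b
  ⇒ᵇ-antisym {false} {false} _ _ = refl
  ⇒ᵇ-antisym {true}  {true}  _ _ = refl

  ⇒ᵇ-∨ : ∀ {a b} c → T (a ⇒ᵇ b) → T (a ∨ c) → T (b ∨ c)
  ⇒ᵇ-∨ {false} {false} c _ t = t
  ⇒ᵇ-∨ {false} {true}  c _ _ = tt
  ⇒ᵇ-∨ {true}  {true}  c _ _ = tt

module ListSums where

  open import Data.Bool using (Bool; true; false; _∧_; if_then_else_)
  open import Data.Nat using (ℕ; suc; _+_; _*_)
  open import Data.Nat.Properties using (+-identityʳ; *-zeroʳ; *-comm; *-distribˡ-+)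
  open import Data.Nat.ListAction using (sum)
  open import Data.Nat.ListAction.Properties using (sum-++)
  open import Data.List using (List; []; _∷_; map; length; _++_; filter; cartesianProduct)
  open import Data.List.Properties using (map-cong; map-++)
  open import Data.Product using (_×_; _,_)
  open import Function using (_∘_)
  open import Relation.Binary.PropositionalEquality using (_≡_; refl; sym; trans; cong; cong₂; module ≡-Reasoning)
  open import Relation.Nullary.Decidable using (T?)
  open import Data.Nat.Tactic.RingSolver using (solve-∀)

  private
    variable
      A B : Set

  ∑ : List A → (A → ℕ) → ℕ
  ∑ xs f = sum (map f xs)

  [_] : Bool → ℕ
  [ b ] = if b then 1 else 0

  [∧] : ∀ a b → [ a ∧ b ] ≡ [ a ] * [ b ]
  [∧] false b = refl
  [∧] true  b = sym (+-identityʳ [ b ])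

  ∑-cong : ∀ (xs : List A) {f g : A → ℕ} → (∀ x → f x ≡ g x) → ∑ xs f ≡ ∑ xs g
  ∑-cong xs f≗g = cong sum (map-cong f≗g xs)

  ∑-zero : ∀ (xs : List A) → ∑ xs (λ _ → 0) ≡ 0
  ∑-zero []       = refl
  ∑-zero (x ∷ xs) = ∑-zero xs

  ∑-length : ∀ (xs : List A) → ∑ xs (λ _ → 1) ≡ length xs
  ∑-length []       = refl
  ∑-length (x ∷ xs) = cong suc (∑-length xs)

  ∑-distrib-+ : ∀ (xs : List A) (f g : A → ℕ) → ∑ xs (λ x → f x + g x) ≡ ∑ xs f + ∑ xs g
  ∑-distrib-+ []       f g = refl
  ∑-distrib-+ (x ∷ xs) f g = begin
    f x + g x + ∑ xs (λ x → f x + g x)   ≡⟨ cong (f x + g x +_) (∑-distrib-+ xs f g) ⟩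
    f x + g x + (∑ xs f + ∑ xs g)        ≡⟨ interchange (f x) (g x) (∑ xs f) (∑ xs g) ⟩
    f x + ∑ xs f + (g x + ∑ xs g)        ∎
    where
    open ≡-Reasoning
    interchange : ∀ a b c d → a + b + (c + d) ≡ a + c + (b + d)
    interchange = solve-∀

  *-distribˡ-∑ : ∀ c (xs : List A) (f : A → ℕ) → c * ∑ xs f ≡ ∑ xs (λ x → c * f x)
  *-distribˡ-∑ c []       f = *-zeroʳ c
  *-distribˡ-∑ c (x ∷ xs) f = trans (*-distribˡ-+ c (f x) (∑ xs f)) (cong (c * f x +_) (*-distribˡ-∑ c xs f))

  *-distribʳ-∑ : ∀ c (xs : List A) (f : A → ℕ) → ∑ xs f * c ≡ ∑ xs (λ x → f x * c)
  *-distribʳ-∑ c xs f = trans (*-comm (∑ xs f) c) (trans (*-distribˡ-∑ c xs f) (∑-cong xs (λ x → *-comm c (f x))))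

  ∑-comm : ∀ (xs : List A) (ys : List B) (f : A → B → ℕ) →
           ∑ xs (λ x → ∑ ys (f x)) ≡ ∑ ys (λ y → ∑ xs (λ x → f x y))
  ∑-comm []       ys f = sym (∑-zero ys)
  ∑-comm (x ∷ xs) ys f = trans (cong (∑ ys (f x) +_) (∑-comm xs ys f))
                               (sym (∑-distrib-+ ys (f x) (λ y → ∑ xs (λ x → f x y))))

  ∑-++ : ∀ (xs ys : List A) (f : A → ℕ) → ∑ (xs ++ ys) f ≡ ∑ xs f + ∑ ys f
  ∑-++ xs ys f = trans (cong sum (map-++ f xs ys)) (sum-++ (map f xs) (map f ys))

  ∑-map : ∀ (g : A → B) (xs : List A) (f : B → ℕ) → ∑ (map g xs) f ≡ ∑ xs (f ∘ g)
  ∑-map g []       f = refl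
  ∑-map g (x ∷ xs) f = cong (f (g x) +_) (∑-map g xs f)

  ∑-cartesianProduct : ∀ (xs : List A) (ys : List B) (f : A × B → ℕ) →
                       ∑ (cartesianProduct xs ys) f ≡ ∑ xs (λ x → ∑ ys (λ y → f (x , y)))
  ∑-cartesianProduct []       ys f = refl
  ∑-cartesianProduct (x ∷ xs) ys f = begin
    ∑ (map (x ,_) ys ++ cartesianProduct xs ys) f               ≡⟨ ∑-++ (map (x ,_) ys) _ f ⟩
    ∑ (map (x ,_) ys) f + ∑ (cartesianProduct xs ys) f          ≡⟨ cong₂ _+_ (∑-map (x ,_) ys f) (∑-cartesianProduct xs ys f) ⟩
    ∑ ys (λ y → f (x , y)) + ∑ xs (λ x → ∑ ys (λ y → f (x , y))) ∎
    where open ≡-Reasoning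

  ∑-product : ∀ (xs : List A) (ys : List B) (f : A → ℕ) (g : B → ℕ) →
              ∑ (cartesianProduct xs ys) (λ (x , y) → f x * g y) ≡ ∑ xs f * ∑ ys g
  ∑-product xs ys f g = begin
    ∑ (cartesianProduct xs ys) (λ (x , y) → f x * g y) ≡⟨ ∑-cartesianProduct xs ys _ ⟩
    ∑ xs (λ x → ∑ ys (λ y → f x * g y))                ≡⟨ ∑-cong xs (λ x → sym (*-distribˡ-∑ (f x) ys g)) ⟩
    ∑ xs (λ x → f x * ∑ ys g)                          ≡⟨ sym (*-distribʳ-∑ (∑ ys g) xs f) ⟩
    ∑ xs f * ∑ ys g                                    ∎
    where open ≡-Reasoning

  ∑-filter : ∀ (P : A → Bool) (xs : List A) (f : A → ℕ) →
             ∑ (filter (T? ∘ P) xs) f ≡ ∑ xs (λ x → if P x then f x else 0)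
  ∑-filter P []       f = refl
  ∑-filter P (x ∷ xs) f with P x
  ... | true  = cong (f x +_) (∑-filter P xs f)
  ... | false = ∑-filter P xs f

module FinSums where

  open import Data.Fin using (Fin; zero; suc; toℕ; _↑ˡ_; _↑ʳ_)
  open import Data.Fin.Properties using (toℕ-↑ˡ; toℕ-↑ʳ; toℕ<n)
  open import Data.Nat using (ℕ; zero; suc; _+_; _*_; _<_; z<s; s≤s)
  open import Data.Nat.Divisibility using (_∣_; _∣?_; _∣0; ∣⇒≤; ∣m+n∣m⇒∣n; ∣m∣n⇒∣m+n; ∣-refl)
  open import Data.Nat.Properties using (+-assoc; <⇒≱; +-0-commutativeMonoid)
  open import Algebra.Properties.CommutativeMonoid.Sum +-0-commutativeMonoid using (sum-syntax; sum-cong-≗; sum-replicate-zero)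
  open import Data.List using (tabulate)
  open import Function using (_∘_)
  open import Relation.Binary.PropositionalEquality using (_≡_; refl; sym; trans; cong; cong₂; module ≡-Reasoning)
  open import Relation.Nullary.Decidable using (does; dec-true; dec-false)
  open ListSums

  ∑-tabulate : ∀ {A : Set} {m} (h : Fin m → A) (f : A → ℕ) → ∑ (tabulate h) f ≡ ∑[ i < m ] f (h i)
  ∑-tabulate {m = zero}  h f = refl
  ∑-tabulate {m = suc m} h f = cong (f (h zero) +_) (∑-tabulate (h ∘ suc) f)

  ∑-↑ : ∀ m {l} (f : Fin (m + l) → ℕ) → ∑[ i < m + l ] f i ≡ ∑[ i < m ] f (i ↑ˡ l) + ∑[ j < l ] f (m ↑ʳ j)
  ∑-↑ zero    f = refl
  ∑-↑ (suc m) f = trans (cong (f zero +_) (∑-↑ m (f ∘ suc))) (sym (+-assoc (f zero) _ _))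

  ∑-multiples-period : ∀ {d} c → 0 < d → d ∣ c → ∑[ k < d ] [ does (d ∣? (c + toℕ k)) ] ≡ 1
  ∑-multiples-period {suc d} c z<s d∣c = begin
    [ does (suc d ∣? (c + 0)) ] + ∑[ k < d ] [ does (suc d ∣? (c + suc (toℕ k))) ] ≡⟨ cong₂ _+_ first (sum-cong-≗ rest) ⟩
    1 + ∑[ k < d ] 0                                                               ≡⟨ cong (1 +_) (sum-replicate-zero d) ⟩
    1                                                                              ∎
    where
    open ≡-Reasoning
    first : [ does (suc d ∣? (c + 0)) ] ≡ 1
    first = cong [_] (dec-true (suc d ∣? (c + 0)) (∣m∣n⇒∣m+n d∣c (suc d ∣0)))
    rest : ∀ k → [ does (suc d ∣? (c + suc (toℕ k))) ] ≡ 0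
    rest k = cong [_] (dec-false (suc d ∣? _) λ d∣c+k → <⇒≱ (s≤s (toℕ<n k)) (∣⇒≤ (∣m+n∣m⇒∣n d∣c+k d∣c)))

  ∑-multiples : ∀ a {d} → 0 < d → ∑[ k < a * d ] [ does (d ∣? toℕ k) ] ≡ a
  ∑-multiples a {d} 0<d = shifted a 0 (d ∣0)
    where
    χ : ℕ → ℕ
    χ i = [ does (d ∣? i) ]
    shifted : ∀ a c → d ∣ c → ∑[ k < a * d ] χ (c + toℕ k) ≡ a
    shifted zero    c d∣c = refl
    shifted (suc a) c d∣c = begin
      ∑[ k < d + a * d ] χ (c + toℕ k)                                         ≡⟨ ∑-↑ d _ ⟩
      ∑[ k < d ] χ (c + toℕ (k ↑ˡ a * d)) + ∑[ k < a * d ] χ (c + toℕ (d ↑ʳ k)) ≡⟨ cong₂ _+_ first-period later-periods ⟩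
      1 + a                                                                     ∎
      where
      open ≡-Reasoning
      first-period : ∑[ k < d ] χ (c + toℕ (k ↑ˡ a * d)) ≡ 1
      first-period = trans (sum-cong-≗ {d} (λ k → cong (λ i → χ (c + i)) (toℕ-↑ˡ k (a * d)))) (∑-multiples-period c 0<d d∣c)
      later-periods : ∑[ k < a * d ] χ (c + toℕ (d ↑ʳ k)) ≡ a
      later-periods = trans (sum-cong-≗ {a * d} (λ k → cong χ (trans (cong (c +_) (toℕ-↑ʳ d k)) (sym (+-assoc c d (toℕ k))))))
                            (shifted a (c + d) (∣m∣n⇒∣m+n d∣c ∣-refl))

module Subsets where

  open import Data.Bool using (Bool; true; false; T; if_then_else_)
  open import Data.Bool.ListAction using (all)
  open import Data.Bool.Properties using () renaming (_≟_ to _≟ᵇ_)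
  open import Data.List using (map)
  open import Data.List.Membership.Propositional using () renaming (_∈_ to _∈ˡ_)
  open import Data.List.Membership.Propositional.Properties using (∈-map⁺; ∈-++⁺ˡ; ∈-++⁺ʳ)
  open import Data.List.Relation.Unary.Any using (here)
  open import Data.Nat using (ℕ; suc; _+_)
  open import Data.Nat.Properties using (+-identityʳ)
  open import Data.Vec using ([]; _∷_)
  open import Data.Vec.Properties using (≡-dec)
  open import Function using (_⇔_; mk⇔; Equivalence)
  open import Relation.Binary.Definitions using (DecidableEquality)
  open import Relation.Binary.PropositionalEquality using (_≡_; refl; trans; cong₂; module ≡-Reasoning)
  open import Relation.Nullary.Decidable using (does)
  open ListSums
  open Booleans
  open Equivalence

  ∈-allSubsets : ∀ {m} (v : Subset m) → v ∈ˡ allSubsets m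
  ∈-allSubsets []                  = here refl
  ∈-allSubsets         (true  ∷ v) = ∈-++⁺ˡ (∈-map⁺ (true ∷_) (∈-allSubsets v))
  ∈-allSubsets {suc m} (false ∷ v) = ∈-++⁺ʳ (map (true ∷_) (allSubsets m)) (∈-map⁺ (false ∷_) (∈-allSubsets v))

  T-all-subsets : ∀ {m} {f : Subset m → Bool} → T (all f (allSubsets m)) ⇔ (∀ K → T (f K))
  T-all-subsets {m} {f} = mk⇔ (λ t K → to (T-all {f = f} {allSubsets m}) t K (∈-allSubsets K))
                              (λ h → from (T-all {f = f} {allSubsets m}) (λ K _ → h K))

  _≟ˢ_ : ∀ {m} → DecidableEquality (Subset m)
  _≟ˢ_ = ≡-dec _≟ᵇ_

  ∑-allSubsets-suc : ∀ {m} (f : Subset (suc m) → ℕ) →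
                     ∑ (allSubsets (suc m)) f ≡ ∑ (allSubsets m) (λ S → f (true ∷ S)) + ∑ (allSubsets m) (λ S → f (false ∷ S))
  ∑-allSubsets-suc {m} f = trans (∑-++ (map (true ∷_) (allSubsets m)) _ f)
                                 (cong₂ _+_ (∑-map (true ∷_) (allSubsets m) f) (∑-map (false ∷_) (allSubsets m) f))

  ∑-allSubsets-≟ : ∀ {m} (v : Subset m) (f : Subset m → ℕ) →
                   ∑ (allSubsets m) (λ S → if does (S ≟ˢ v) then f S else 0) ≡ f v
  ∑-allSubsets-≟ []                f = +-identityʳ (f [])
  ∑-allSubsets-≟ {suc m} (true ∷ v)  f = begin
    ∑ (allSubsets (suc m)) (λ S → if does (S ≟ˢ (true ∷ v)) then f S else 0)       ≡⟨ ∑-allSubsets-suc {m} _ ⟩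
    ∑ (allSubsets m) (λ S → if does (S ≟ˢ v) then f (true ∷ S) else 0) + ∑ (allSubsets m) (λ _ → 0)
                                                                                 ≡⟨ cong₂ _+_ (∑-allSubsets-≟ v _) (∑-zero (allSubsets m)) ⟩
    f (true ∷ v) + 0                                                             ≡⟨ +-identityʳ _ ⟩
    f (true ∷ v)                                                                 ∎
    where open ≡-Reasoning
  ∑-allSubsets-≟ {suc m} (false ∷ v) f = begin
    ∑ (allSubsets (suc m)) (λ S → if does (S ≟ˢ (false ∷ v)) then f S else 0)      ≡⟨ ∑-allSubsets-suc {m} _ ⟩
    ∑ (allSubsets m) (λ _ → 0) + ∑ (allSubsets m) (λ S → if does (S ≟ˢ v) then f (false ∷ S) else 0)
                                                                                 ≡⟨ cong₂ _+_ (∑-zero (allSubsets m)) refl ⟩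
    ∑ (allSubsets m) (λ S → if does (S ≟ˢ v) then f (false ∷ S) else 0)           ≡⟨ ∑-allSubsets-≟ v _ ⟩
    f (false ∷ v)                                                                ∎
    where open ≡-Reasoning

module SubgroupGraph {n : ℕ} (_∙_ : Fin n → Fin n → Fin n) (e : Fin n) (inv : Fin n → Fin n) where

  open import Data.Bool using (Bool; true; false; T; _∧_; if_then_else_)
  open import Data.Bool.ListAction using (all)
  open import Data.Bool.Properties using (T-∧; T-≡)
  open import Data.Nat using (_+_; _*_; _^_)
  open import Data.Nat.Properties using (*-identityʳ; *-zeroʳ)
  open import Data.List using (length)
  open import Data.List.Properties using (length-tabulate)
  open import Data.List.Membership.Propositional.Properties using (∈-allFin)
  open import Data.Product using (_×_; _,_)
  open import Data.Vec using (lookup; tabulate)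
  open import Data.Vec.Properties using (lookup∘tabulate; tabulate∘lookup; tabulate-cong)
  open import Data.Unit using (tt)
  open import Function using (_⇔_; mk⇔; Equivalence)
  open import Relation.Binary.PropositionalEquality using (_≡_; refl; sym; trans; cong; cong₂; subst; module ≡-Reasoning)
  open import Relation.Nullary.Decidable using (does; yes; no)
  open ListSums
  open Booleans
  open Subsets

  open SGB _∙_ e inv public
  open Equivalence

  infix 4 _∈_ _⊆_

  _∈_ : Fin n → Subset n → Set
  x ∈ H = T (x ∈ᵇ H)

  _⊆_ : Subset n → Subset n → Set
  H ⊆ K = ∀ x → x ∈ H → x ∈ K

  record IsSubgroup (H : Subset n) : Set where
    field
      e∈ : e ∈ H
      ∙-closed : ∀ {x y} → x ∈ H → y ∈ H → x ∙ y ∈ H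
      inv-closed : ∀ {x} → x ∈ H → inv x ∈ H

  Generates : Fin n × Fin n → Subset n → Set
  Generates (a , b) H = IsSubgroup H × a ∈ H × b ∈ H × (∀ K → IsSubgroup K → a ∈ K → b ∈ K → H ⊆ K)

  T-all-elems : ∀ {f : Fin n → Bool} → T (all f elems) ⇔ (∀ x → T (f x))
  T-all-elems {f} = mk⇔ (λ t x → to (T-all {f = f} {elems}) t x (∈-allFin x)) (λ h → from (T-all {f = f} {elems}) (λ x _ → h x))

  ∙-closedᵇ inv-closedᵇ : Subset n → Bool
  ∙-closedᵇ H = all (λ x → all (λ y → ((x ∈ᵇ H) ∧ (y ∈ᵇ H)) ⇒ᵇ ((x ∙ y) ∈ᵇ H)) elems) elems
  inv-closedᵇ H = all (λ x → (x ∈ᵇ H) ⇒ᵇ (inv x ∈ᵇ H)) elems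

  isSubgroup⇔ : ∀ {H} → T (isSubgroup H) ⇔ IsSubgroup H
  isSubgroup⇔ {H} = mk⇔ toRecord fromRecord
    where
    toRecord : T (isSubgroup H) → IsSubgroup H
    toRecord t =
      let e∈ , closed = to (T-∧ {e ∈ᵇ H}) t
          ∙-closedᵇH , inv-closedᵇH = to (T-∧ {∙-closedᵇ H}) closed
      in record
        { e∈         = e∈
        ; ∙-closed   = λ {x} {y} x∈ y∈ → to T-⇒ᵇ (to T-all-elems (to T-all-elems ∙-closedᵇH x) y) (from T-∧ (x∈ , y∈))
        ; inv-closed = λ {x} x∈ → to T-⇒ᵇ (to T-all-elems inv-closedᵇH x) x∈
        }
    fromRecord : IsSubgroup H → T (isSubgroup H)
    fromRecord s = from T-∧ (e∈ , from T-∧ (∙-closedᵇH , inv-closedᵇH))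
      where
      open IsSubgroup s
      ∙-closedᵇH : T (∙-closedᵇ H)
      ∙-closedᵇH = from T-all-elems λ x → from T-all-elems λ y → from T-⇒ᵇ λ xy∈ →
        let x∈ , y∈ = to (T-∧ {x ∈ᵇ H}) xy∈ in ∙-closed x∈ y∈
      inv-closedᵇH : T (inv-closedᵇ H)
      inv-closedᵇH = from T-all-elems λ x → from T-⇒ᵇ inv-closed

  ⊆ᵇ⇔ : ∀ {H K} → T (H ⊆ᵇ K) ⇔ H ⊆ K
  ⊆ᵇ⇔ = mk⇔ (λ t x → to T-⇒ᵇ (to T-all-elems t x)) (λ H⊆K → from T-all-elems (λ x → from T-⇒ᵇ (H⊆K x)))

  generates⇔ : ∀ {a b H} → T (generates (a , b) H) ⇔ Generates (a , b) H
  generates⇔ {a} {b} {H} = mk⇔ toGenerates fromGenerates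
    where
    toGenerates : T (generates (a , b) H) → Generates (a , b) H
    toGenerates t =
      let H-sub , t₁ = to (T-∧ {isSubgroup H}) t
          a∈ , t₂    = to (T-∧ {a ∈ᵇ H}) t₁
          b∈ , least = to (T-∧ {b ∈ᵇ H}) t₂
      in to isSubgroup⇔ H-sub , a∈ , b∈ , λ K K-sub a∈K b∈K →
           to (⊆ᵇ⇔ {H} {K}) (to T-⇒ᵇ (to T-all-subsets least K) (from T-∧ (from isSubgroup⇔ K-sub , from T-∧ (a∈K , b∈K))))
    fromGenerates : Generates (a , b) H → T (generates (a , b) H)
    fromGenerates (H-sub , a∈ , b∈ , least) =
      from T-∧ (from isSubgroup⇔ H-sub , from T-∧ (a∈ , from T-∧ (b∈ , from T-all-subsets λ K → from T-⇒ᵇ λ t →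
        let K-sub , t₁ = to (T-∧ {isSubgroup K}) t
            a∈K , b∈K  = to (T-∧ {a ∈ᵇ K}) t₁
        in from (⊆ᵇ⇔ {H} {K}) (least K (to isSubgroup⇔ K-sub) a∈K b∈K))))

  ⊆-antisym : ∀ {H K} → H ⊆ K → K ⊆ H → H ≡ K
  ⊆-antisym {H} {K} H⊆K K⊆H = begin
    H                  ≡⟨ tabulate∘lookup H ⟨
    tabulate (lookup H) ≡⟨ tabulate-cong (λ x → T-injective (H⊆K x) (K⊆H x)) ⟩
    tabulate (lookup K) ≡⟨ tabulate∘lookup K ⟩
    K                  ∎
    where open ≡-Reasoning

  ⟨_⟩ : Fin n × Fin n → Subset n
  ⟨ a , b ⟩ = tabulate (λ x → all (λ K → (isSubgroup K ∧ (a ∈ᵇ K) ∧ (b ∈ᵇ K)) ⇒ᵇ (x ∈ᵇ K)) (allSubsets n))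

  ∈⟨⟩⇔ : ∀ {a b x} → x ∈ ⟨ a , b ⟩ ⇔ (∀ K → IsSubgroup K → a ∈ K → b ∈ K → x ∈ K)
  ∈⟨⟩⇔ {a} {b} {x} = mk⇔
    (λ x∈ K K-sub a∈K b∈K → to T-⇒ᵇ (to T-all-subsets (subst T (lookup∘tabulate _ x) x∈) K)
                                   (from T-∧ (from isSubgroup⇔ K-sub , from T-∧ (a∈K , b∈K))))
    (λ h → subst T (sym (lookup∘tabulate _ x)) (from T-all-subsets λ K → from T-⇒ᵇ λ t →
       let K-sub , t₁ = to (T-∧ {isSubgroup K}) t
           a∈K , b∈K  = to (T-∧ {a ∈ᵇ K}) t₁
       in h K (to isSubgroup⇔ K-sub) a∈K b∈K))

  ⟨⟩-generates : ∀ ab → Generates ab ⟨ ab ⟩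
  ⟨⟩-generates (a , b) = ⟨⟩-subgroup
                       , from ∈⟨⟩⇔ (λ _ _ a∈K _ → a∈K)
                       , from ∈⟨⟩⇔ (λ _ _ _ b∈K → b∈K)
                       , λ K K-sub a∈K b∈K x x∈ → to ∈⟨⟩⇔ x∈ K K-sub a∈K b∈K
    where
    ⟨⟩-subgroup : IsSubgroup ⟨ a , b ⟩
    ⟨⟩-subgroup = record
      { e∈         = from ∈⟨⟩⇔ (λ K K-sub _ _ → IsSubgroup.e∈ K-sub)
      ; ∙-closed   = λ x∈ y∈ → from ∈⟨⟩⇔ λ K K-sub a∈K b∈K →
                       IsSubgroup.∙-closed K-sub (to ∈⟨⟩⇔ x∈ K K-sub a∈K b∈K) (to ∈⟨⟩⇔ y∈ K K-sub a∈K b∈K)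
      ; inv-closed = λ x∈ → from ∈⟨⟩⇔ λ K K-sub a∈K b∈K → IsSubgroup.inv-closed K-sub (to ∈⟨⟩⇔ x∈ K K-sub a∈K b∈K)
      }

  Generates-unique : ∀ {a b H K} → Generates (a , b) H → Generates (a , b) K → H ≡ K
  Generates-unique (H-sub , a∈H , b∈H , H-least) (K-sub , a∈K , b∈K , K-least) =
    ⊆-antisym (H-least _ K-sub a∈K b∈K) (K-least _ H-sub a∈H b∈H)

  ∑-L : ∀ (f : Subset n → ℕ) → ∑ L f ≡ ∑ (allSubsets n) (λ S → if isSubgroup S then f S else 0)
  ∑-L = ∑-filter isSubgroup (allSubsets n)

  generates≡≟⟨⟩ : ∀ ab S → generates ab S ≡ does (S ≟ˢ ⟨ ab ⟩)
  generates≡≟⟨⟩ (a , b) S with S ≟ˢ ⟨ a , b ⟩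
  ... | yes refl = to T-≡ (from generates⇔ (⟨⟩-generates (a , b)))
  ... | no  S≢⟨⟩ = T-injective (λ t → S≢⟨⟩ (Generates-unique (to generates⇔ t) (⟨⟩-generates (a , b)))) λ ()

  if-∧ : ∀ b c → (if b then [ b ∧ c ] else 0) ≡ [ b ∧ c ]
  if-∧ false c = refl
  if-∧ true  c = refl

  degPair≡1 : ∀ ab → degPair ab ≡ 1
  degPair≡1 ab = begin
    ∑ L (λ S → [ generates ab S ])                                      ≡⟨ ∑-L _ ⟩
    ∑ (allSubsets n) (λ S → if isSubgroup S then [ generates ab S ] else 0) ≡⟨ ∑-cong (allSubsets n) (λ S → if-∧ (isSubgroup S) _) ⟩
    ∑ (allSubsets n) (λ S → [ generates ab S ])                          ≡⟨ ∑-cong (allSubsets n) (λ S → cong [_] (generates≡≟⟨⟩ ab S)) ⟩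
    ∑ (allSubsets n) (λ S → [ does (S ≟ˢ ⟨ ab ⟩) ])                      ≡⟨ ∑-allSubsets-≟ ⟨ ab ⟩ (λ _ → 1) ⟩
    1                                                                    ∎
    where open ≡-Reasoning

  order : Subset n → ℕ
  order K = count (_∈ᵇ K) elems

  ∑-elems-1 : ∑ elems (λ _ → 1) ≡ n
  ∑-elems-1 = trans (∑-length elems) (length-tabulate (λ x → x))

  ∑-pairs-1 : ∑ pairs (λ _ → 1) ≡ n * n
  ∑-pairs-1 = trans (∑-product elems elems (λ _ → 1) (λ _ → 1)) (cong₂ _*_ ∑-elems-1 ∑-elems-1)

  numEdges≡ : numEdges ≡ n * n
  numEdges≡ = begin
    ∑ L (λ H → ∑ pairs (λ ab → [ generates ab H ])) ≡⟨ ∑-comm L pairs (λ H ab → [ generates ab H ]) ⟩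
    ∑ pairs degPair                                ≡⟨ ∑-cong pairs degPair≡1 ⟩
    ∑ pairs (λ _ → 1)                              ≡⟨ ∑-pairs-1 ⟩
    n * n                                          ∎
    where open ≡-Reasoning

  numVertices≡ : numVertices ≡ n * n + length L
  numVertices≡ = cong (_+ length L) (trans (sym (∑-length pairs)) ∑-pairs-1)

  ^2≡* : ∀ m → m ^ 2 ≡ m * m
  ^2≡* m = cong (m *_) (*-identityʳ m)

  M₁≡ : M₁ ≡ n * n + ∑ L (λ H → degSub H * degSub H)
  M₁≡ = cong₂ _+_ (trans (∑-cong pairs (λ ab → cong (_^ 2) (degPair≡1 ab))) ∑-pairs-1)
                  (∑-cong L (λ H → ^2≡* (degSub H)))

  M₂≡ : M₂ ≡ ∑ L (λ H → degSub H * degSub H)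
  M₂≡ = ∑-cong L λ H → begin
    ∑ pairs (λ ab → if generates ab H then degPair ab * degSub H else 0) ≡⟨ ∑-cong pairs (λ ab → weight ab H) ⟩
    ∑ pairs (λ ab → [ generates ab H ] * degSub H)                      ≡⟨ *-distribʳ-∑ (degSub H) pairs _ ⟨
    degSub H * degSub H                                                 ∎
    where
    open ≡-Reasoning
    weight : ∀ ab H → (if generates ab H then degPair ab * degSub H else 0) ≡ [ generates ab H ] * degSub H
    weight ab H rewrite degPair≡1 ab with generates ab H
    ... | true  = refl
    ... | false = refl

  ⊆-generated⇔ : ∀ {a b H K} → Generates (a , b) H → IsSubgroup K → H ⊆ K ⇔ (a ∈ K × b ∈ K)
  ⊆-generated⇔ (_ , a∈H , b∈H , least) K-sub = mk⇔ (λ H⊆K → H⊆K _ a∈H , H⊆K _ b∈H) (λ (a∈K , b∈K) → least _ K-sub a∈K b∈K)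

  -- A pair generates a subgroup of K exactly when both of its entries lie in K.
  ∑-degSub-⊆ : ∀ {K} → IsSubgroup K → ∑ L (λ H → [ H ⊆ᵇ K ] * degSub H) ≡ order K * order K
  ∑-degSub-⊆ {K} K-sub = begin
    ∑ L (λ H → [ H ⊆ᵇ K ] * ∑ pairs (λ ab → [ generates ab H ]))   ≡⟨ ∑-cong L (λ H → *-distribˡ-∑ [ H ⊆ᵇ K ] pairs _) ⟩
    ∑ L (λ H → ∑ pairs (λ ab → [ H ⊆ᵇ K ] * [ generates ab H ]))   ≡⟨ ∑-comm L pairs (λ H ab → [ H ⊆ᵇ K ] * [ generates ab H ]) ⟩
    ∑ pairs (λ ab → ∑ L (λ H → [ H ⊆ᵇ K ] * [ generates ab H ]))   ≡⟨ ∑-cong pairs (λ ab → ∑-cong L (indicator ab)) ⟩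
    ∑ pairs (λ ab → ∑ L (λ H → [ both∈ ab ] * [ generates ab H ])) ≡⟨ ∑-cong pairs (λ ab → *-distribˡ-∑ [ both∈ ab ] L _) ⟨
    ∑ pairs (λ ab → [ both∈ ab ] * degPair ab)                     ≡⟨ ∑-cong pairs (λ (a , b) → [both∈] a b) ⟩
    ∑ pairs (λ (a , b) → [ a ∈ᵇ K ] * [ b ∈ᵇ K ])                  ≡⟨ ∑-product elems elems (λ a → [ a ∈ᵇ K ]) (λ b → [ b ∈ᵇ K ]) ⟩
    order K * order K                                              ∎
    where
    open ≡-Reasoning
    both∈ : Fin n × Fin n → Bool
    both∈ (a , b) = a ∈ᵇ K ∧ b ∈ᵇ K
    indicator : ∀ ab H → [ H ⊆ᵇ K ] * [ generates ab H ] ≡ [ both∈ ab ] * [ generates ab H ]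
    indicator (a , b) H with generates (a , b) H in eq
    ... | false = trans (*-zeroʳ [ H ⊆ᵇ K ]) (sym (*-zeroʳ [ both∈ (a , b) ]))
    ... | true  = cong (λ c → [ c ] * 1) (T-injective {H ⊆ᵇ K}
                    (λ t → from T-∧ (to H⊆K⇔ (to (⊆ᵇ⇔ {H} {K}) t)))
                    (λ t → from (⊆ᵇ⇔ {H} {K}) (from H⊆K⇔ (to (T-∧ {a ∈ᵇ K}) t))))
      where H⊆K⇔ = ⊆-generated⇔ {H = H} (to generates⇔ (subst T (sym eq) tt)) K-sub
    [both∈] : ∀ a b → [ both∈ (a , b) ] * degPair (a , b) ≡ [ a ∈ᵇ K ] * [ b ∈ᵇ K ]
    [both∈] a b = trans (cong ([ both∈ (a , b) ] *_) (degPair≡1 (a , b))) (trans (*-identityʳ _) ([∧] (a ∈ᵇ K) (b ∈ᵇ K)))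

module CyclicGroup {n : ℕ} {_∙_ : Fin n → Fin n → Fin n} {e : Fin n} {inv : Fin n → Fin n}
  (isGroup : IsGroup _≡_ _∙_ e inv) (g : Fin n) (generated : ∀ x → ∃ λ k → x ≡ pow _∙_ e g k) where

  open import Algebra.Bundles using (Group)
  open import Data.Fin using (toℕ; fromℕ<)
  open import Data.Fin.Permutation using (Permutation; permutation)
  open import Data.Fin.Properties using (toℕ<n; toℕ-fromℕ<; toℕ-injective; pigeonhole; injective⇒≤; nonZeroIndex)
  open import Data.List using (allFin)
  open import Data.Nat using (zero; suc; _+_; _*_; _∸_; _%_; _/_; _≤_; _<_; NonZero; >-nonZero; >-nonZero⁻¹; s≤s⁻¹)
  open import Data.Nat.Coprimality using (Coprime; coprime-Bézout)
  open import Data.Nat.DivMod using (m≡m%n+[m/n]*n; m%n<n; m<n⇒m%n≡m)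
  open import Data.Nat.Divisibility using (_∣_; divides; %-presˡ-∣; ∣m∣n⇒∣m+n; ∣m+n∣m⇒∣n; ∣n⇒∣m*n)
  open import Data.Nat.GCD using (module Bézout)
  open import Data.Nat.Properties
    using (+-0-commutativeMonoid; m+[n∸m]≡n; <⇒≤; m<n⇒0<n∸m; ≤-antisym; ≤-trans; m∸n≤m; n<1+n; <-cmp; <⇒≱; ≤-<-trans)
  open import Data.Nat.Tactic.RingSolver using (solve-∀)
  open import Algebra.Properties.CommutativeMonoid.Sum +-0-commutativeMonoid using (sum-syntax; sum-cong-≗; sum-permute)
  open import Data.Product using (_,_; proj₁; proj₂)
  open import Relation.Binary using (tri<; tri≈; tri>)
  open import Relation.Binary.PropositionalEquality using (refl; sym; trans; cong; cong₂; subst; module ≡-Reasoning)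
  open import Relation.Nullary using (contradiction)
  open ListSums using (∑)
  open FinSums using (∑-tabulate)
  open SubgroupGraph _∙_ e inv using (IsSubgroup; _∈_)

  group : Group _ _
  group = record { isGroup = isGroup }

  open IsGroup isGroup using (assoc; identityˡ; identityʳ; inverseʳ)
  open import Algebra.Properties.Group group using (∙-cancelˡ; inverseʳ-unique; inverseˡ-unique)
  open import Algebra.Properties.Monoid.Mult (Group.monoid group) using (_×_; ×-homo-+; ×-assocˡ)

  infixr 8 _^_

  _^_ : Fin n → ℕ → Fin n
  x ^ k = pow _∙_ e x k

  ^≡× : ∀ x k → x ^ k ≡ k × x
  ^≡× x zero    = refl
  ^≡× x (suc k) = cong (x ∙_) (^≡× x k)

  ^-+ : ∀ x i j → x ^ (i + j) ≡ (x ^ i) ∙ (x ^ j)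
  ^-+ x i j = trans (^≡× x (i + j)) (trans (×-homo-+ x i j) (sym (cong₂ _∙_ (^≡× x i) (^≡× x j))))

  ^-* : ∀ x i j → x ^ (i * j) ≡ (x ^ j) ^ i
  ^-* x i j = trans (^≡× x (i * j)) (sym (trans (^≡× (x ^ j) i) (trans (cong (i ×_) (^≡× x j)) (×-assocˡ x i j))))

  e^ : ∀ k → e ^ k ≡ e
  e^ zero    = refl
  e^ (suc k) = trans (cong (e ∙_) (e^ k)) (identityˡ e)

  ^-mod : ∀ {d} .{{_ : NonZero d}} → g ^ d ≡ e → ∀ k → g ^ k ≡ g ^ (k % d)
  ^-mod {d} g^d≡e k = begin
    g ^ k                              ≡⟨ cong (g ^_) (m≡m%n+[m/n]*n k d) ⟩
    g ^ (k % d + k / d * d)            ≡⟨ ^-+ g (k % d) (k / d * d) ⟩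
    (g ^ (k % d)) ∙ (g ^ (k / d * d))  ≡⟨ cong ((g ^ (k % d)) ∙_) (^-* g (k / d) d) ⟩
    (g ^ (k % d)) ∙ ((g ^ d) ^ (k / d)) ≡⟨ cong (λ y → (g ^ (k % d)) ∙ (y ^ (k / d))) g^d≡e ⟩
    (g ^ (k % d)) ∙ (e ^ (k / d))      ≡⟨ cong ((g ^ (k % d)) ∙_) (e^ (k / d)) ⟩
    (g ^ (k % d)) ∙ e                  ≡⟨ identityʳ _ ⟩
    g ^ (k % d)                        ∎
    where open ≡-Reasoning

  -- Every element is among g⁰, …, gᵈ⁻¹.
  n≤period : ∀ d .{{_ : NonZero d}} → g ^ d ≡ e → n ≤ d
  n≤period d g^d≡e = injective⇒≤ {f = residue} residue-injective
    where
    residue : Fin n → Fin d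
    residue x = fromℕ< (m%n<n (proj₁ (generated x)) d)
    x≡g^residue : ∀ x → x ≡ g ^ toℕ (residue x)
    x≡g^residue x = trans (proj₂ (generated x))
      (trans (^-mod g^d≡e (proj₁ (generated x))) (cong (g ^_) (sym (toℕ-fromℕ< (m%n<n (proj₁ (generated x)) d)))))
    residue-injective : ∀ {x y} → residue x ≡ residue y → x ≡ y
    residue-injective {x} {y} eq = trans (x≡g^residue x) (trans (cong (λ i → g ^ toℕ i) eq) (sym (x≡g^residue y)))

  ^-cancel : ∀ i d → g ^ i ≡ g ^ (i + d) → g ^ d ≡ e
  ^-cancel i d eq = ∙-cancelˡ (g ^ i) (g ^ d) e (trans (sym (^-+ g i d)) (trans (sym eq) (sym (identityʳ _))))

  ^-period : ∀ {i j} → i < j → g ^ i ≡ g ^ j → g ^ (j ∸ i) ≡ e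
  ^-period {i} {j} i<j eq = ^-cancel i (j ∸ i) (trans eq (cong (g ^_) (sym (m+[n∸m]≡n (<⇒≤ i<j)))))

  n≤gap : ∀ {i j} → i < j → g ^ i ≡ g ^ j → n ≤ j ∸ i
  n≤gap i<j eq = n≤period _ {{>-nonZero (m<n⇒0<n∸m i<j)}} (^-period i<j eq)

  g^n≡e : g ^ n ≡ e
  g^n≡e =
    let i , j , i<j , eq = pigeonhole (n<1+n n) (λ k → g ^ toℕ k)
        j∸i≡n = ≤-antisym (≤-trans (m∸n≤m (toℕ j) (toℕ i)) (s≤s⁻¹ (toℕ<n j))) (n≤gap i<j eq)
    in subst (λ d → g ^ d ≡ e) j∸i≡n (^-period i<j eq)

  ^-injective : ∀ {i j} → i < n → j < n → g ^ i ≡ g ^ j → i ≡ j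
  ^-injective {i} {j} i<n j<n eq with <-cmp i j
  ... | tri< i<j _ _ = contradiction (n≤gap i<j eq) (<⇒≱ (≤-<-trans (m∸n≤m j i) j<n))
  ... | tri≈ _ i≡j _ = i≡j
  ... | tri> _ _ j<i = contradiction (n≤gap j<i (sym eq)) (<⇒≱ (≤-<-trans (m∸n≤m i j) i<n))

  instance
    n-nonZero : NonZero n
    n-nonZero = nonZeroIndex e

  log : Fin n → ℕ
  log x = proj₁ (generated x) % n

  log<n : ∀ x → log x < n
  log<n x = m%n<n _ n

  ^-log : ∀ x → g ^ log x ≡ x
  ^-log x = sym (trans (proj₂ (generated x)) (^-mod g^n≡e _))

  log-^ : ∀ k → log (g ^ k) ≡ k % n
  log-^ k = ^-injective (log<n _) (m%n<n k n) (trans (^-log (g ^ k)) (^-mod g^n≡e k))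

  log-^< : ∀ {k} → k < n → log (g ^ k) ≡ k
  log-^< {k} k<n = trans (log-^ k) (m<n⇒m%n≡m k<n)

  log-e : log e ≡ 0
  log-e = log-^< (>-nonZero⁻¹ n)

  log-∙ : ∀ x y → log (x ∙ y) ≡ (log x + log y) % n
  log-∙ x y = trans (cong log (sym (trans (^-+ g (log x) (log y)) (cong₂ _∙_ (^-log x) (^-log y))))) (log-^ _)

  log-inv : ∀ x → log (inv x) ≡ (n ∸ log x) % n
  log-inv x = trans (cong log (sym g^[n∸log]≡inv)) (log-^ _)
    where
    g^[n∸log]≡inv : g ^ (n ∸ log x) ≡ inv x
    g^[n∸log]≡inv = inverseʳ-unique x _ (begin
      x ∙ (g ^ (n ∸ log x))                ≡⟨ cong (_∙ (g ^ (n ∸ log x))) (^-log x) ⟨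
      (g ^ log x) ∙ (g ^ (n ∸ log x))      ≡⟨ ^-+ g (log x) (n ∸ log x) ⟨
      g ^ (log x + (n ∸ log x))            ≡⟨ cong (g ^_) (m+[n∸m]≡n (<⇒≤ (log<n x))) ⟩
      g ^ n                                ≡⟨ g^n≡e ⟩
      e                                    ∎)
      where open ≡-Reasoning

  ∑-log : ∀ (h : ℕ → ℕ) → ∑ (allFin n) (λ x → h (log x)) ≡ ∑[ k < n ] h (toℕ k)
  ∑-log h = begin
    ∑ (allFin n) (λ x → h (log x))            ≡⟨ ∑-tabulate (λ x → x) (λ x → h (log x)) ⟩
    ∑[ x < n ] h (log x)                     ≡⟨ sum-cong-≗ {n} (λ x → cong h (toℕ-fromℕ< (log<n x))) ⟨
    ∑[ x < n ] h (toℕ (logᶠ x))              ≡⟨ sum-permute (λ k → h (toℕ k)) π ⟨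
    ∑[ k < n ] h (toℕ k)                     ∎
    where
    open ≡-Reasoning
    logᶠ : Fin n → Fin n
    logᶠ x = fromℕ< (log<n x)
    π : Permutation n n
    π = permutation logᶠ (λ k → g ^ toℕ k)
          (λ k → toℕ-injective (trans (toℕ-fromℕ< _) (log-^< (toℕ<n k))))
          (λ x → trans (cong (g ^_) (toℕ-fromℕ< (log<n x))) (^-log x))

  ∣log-∙ : ∀ {d x y} → d ∣ n → d ∣ log x → d ∣ log y → d ∣ log (x ∙ y)
  ∣log-∙ {x = x} {y} d∣n d∣x d∣y = subst (_ ∣_) (sym (log-∙ x y)) (%-presˡ-∣ (∣m∣n⇒∣m+n d∣x d∣y) d∣n)

  ∣log-inv : ∀ {d x} → d ∣ n → d ∣ log x → d ∣ log (inv x)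
  ∣log-inv {x = x} d∣n d∣x = subst (_ ∣_) (sym (log-inv x))
    (%-presˡ-∣ (∣m+n∣m⇒∣n (subst (_ ∣_) (sym (m+[n∸m]≡n (<⇒≤ (log<n x)))) d∣n) d∣x) d∣n)

  g^-multiple : ∀ {k} → n ∣ k → g ^ k ≡ e
  g^-multiple (divides j refl) = trans (^-* g j n) (trans (cong (_^ j) g^n≡e) (e^ j))

  scale-+- : ∀ r u v a b → 1 + u * a ≡ v * b → r + u * (r * a) ≡ v * (r * b)
  scale-+- r u v a b eq = trans (lhs r u a) (trans (cong (r *_) eq) (rhs r v b))
    where
    lhs : ∀ r u a → r + u * (r * a) ≡ r * (1 + u * a)
    lhs = solve-∀
    rhs : ∀ r v b → r * (v * b) ≡ v * (r * b)
    rhs = solve-∀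

  module _ {H : Subset n} (H-sub : IsSubgroup H) where
    open IsSubgroup H-sub

    ^-∈ : ∀ {x} k → x ∈ H → x ^ k ∈ H
    ^-∈ zero    x∈ = e∈
    ^-∈ (suc k) x∈ = ∙-closed x∈ (^-∈ k x∈)

    -- Bézout: from 1 ± u j = v m we get r ± u (r j) = v (r m), and g^(v (r m)) = e.
    g^r∈ : ∀ {r j m} → g ^ (r * j) ∈ H → Coprime j m → n ∣ r * m → g ^ r ∈ H
    g^r∈ {r} {j} {m} g^rj∈ j⊥m n∣rm with coprime-Bézout j⊥m
    ... | Bézout.+- u v 1+vm≡uj = subst (_∈ H) g^rj^u≡g^r (^-∈ u g^rj∈)
      where
      g^rj^u≡g^r : (g ^ (r * j)) ^ u ≡ g ^ r
      g^rj^u≡g^r = begin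
        (g ^ (r * j)) ^ u                  ≡⟨ ^-* g u (r * j) ⟨
        g ^ (u * (r * j))                  ≡⟨ cong (g ^_) (scale-+- r v u m j 1+vm≡uj) ⟨
        g ^ (r + v * (r * m))              ≡⟨ ^-+ g r (v * (r * m)) ⟩
        (g ^ r) ∙ (g ^ (v * (r * m)))      ≡⟨ cong ((g ^ r) ∙_) (g^-multiple (∣n⇒∣m*n v n∣rm)) ⟩
        (g ^ r) ∙ e                        ≡⟨ identityʳ (g ^ r) ⟩
        g ^ r                              ∎
        where open ≡-Reasoning
    ... | Bézout.-+ u v 1+uj≡vm = subst (_∈ H) (sym g^r≡inv) (inv-closed (^-∈ u g^rj∈))
      where
      g^r≡inv : g ^ r ≡ inv ((g ^ (r * j)) ^ u)
      g^r≡inv = inverseˡ-unique (g ^ r) _ (begin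
        (g ^ r) ∙ ((g ^ (r * j)) ^ u)      ≡⟨ cong ((g ^ r) ∙_) (^-* g u (r * j)) ⟨
        (g ^ r) ∙ (g ^ (u * (r * j)))      ≡⟨ ^-+ g r (u * (r * j)) ⟨
        g ^ (r + u * (r * j))              ≡⟨ cong (g ^_) (scale-+- r u v j m 1+uj≡vm) ⟩
        g ^ (v * (r * m))                  ≡⟨ g^-multiple (∣n⇒∣m*n v n∣rm) ⟩
        e                                  ∎)
        where open ≡-Reasoning

    multiples-∈ : ∀ {y r j m x} → y ∈ H → log y ≡ r * j → Coprime j m → n ∣ r * m → r ∣ log x → x ∈ H
    multiples-∈ {y} {r} {x = x} y∈ log-y≡rj j⊥m n∣rm (divides i log-x≡ir) =
      subst (_∈ H) x≡g^r^i (^-∈ i (g^r∈ {r} (subst (_∈ H) (trans (sym (^-log y)) (cong (g ^_) log-y≡rj)) y∈) j⊥m n∣rm))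
      where
      x≡g^r^i : (g ^ r) ^ i ≡ x
      x≡g^r^i = trans (sym (^-* g i r)) (trans (cong (g ^_) (sym log-x≡ir)) (^-log x))

module Primes where

  open import Data.Nat using (ℕ; _*_; _<_; nonTrivial⇒n>1)
  open import Data.Nat.Coprimality using (Coprime; coprime-divisor)
  open import Data.Nat.Divisibility using (_∣_; divides; ∣-trans; ∣1⇒≡1; *-monoˡ-∣)
  open import Data.Nat.Primality using (Prime; prime⇒irreducible; prime⇒nonTrivial; ¬prime[1])
  open import Data.Nat.Properties using (*-comm)
  open import Data.Product using (_,_)
  open import Data.Sum using (inj₁; inj₂)
  open import Relation.Binary.PropositionalEquality using (_≢_; refl; subst)
  open import Relation.Nullary using (¬_; contradiction)

  private
    variable
      p q r k : ℕ

  prime>1 : Prime p → 1 < p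
  prime>1 {p} p-prime = nonTrivial⇒n>1 p {{prime⇒nonTrivial p-prime}}

  prime∤⇒coprime : Prime p → ¬ p ∣ k → Coprime k p
  prime∤⇒coprime p-prime p∤k (d∣k , d∣p) with prime⇒irreducible p-prime d∣p
  ... | inj₁ d≡1  = d≡1
  ... | inj₂ refl = contradiction d∣k p∤k

  prime∤1 : Prime p → ¬ p ∣ 1
  prime∤1 p-prime p∣1 = ¬prime[1] (subst Prime (∣1⇒≡1 p∣1) p-prime)

  prime∤prime : Prime p → Prime q → p ≢ q → ¬ p ∣ q
  prime∤prime p-prime q-prime p≢q p∣q with prime⇒irreducible q-prime p∣q
  ... | inj₁ refl = ¬prime[1] p-prime
  ... | inj₂ p≡q  = p≢q p≡q

  ∣∧∣⇒*∣ : Prime p → Prime q → p ≢ q → p ∣ k → q ∣ k → p * q ∣ k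
  ∣∧∣⇒*∣ {p} {q} p-prime q-prime p≢q (divides k′ refl) q∣k′p =
    subst (_∣ k′ * p) (*-comm q p) (*-monoˡ-∣ p q∣k′)
    where
    q∣k′ : q ∣ k′
    q∣k′ = coprime-divisor (prime∤⇒coprime p-prime (prime∤prime p-prime q-prime p≢q))
             (subst (q ∣_) (*-comm k′ p) q∣k′p)

  ∤∧∤⇒coprime : Prime p → Prime q → ¬ p ∣ k → ¬ q ∣ k → Coprime k (p * q)
  ∤∧∤⇒coprime {p} {q} p-prime q-prime p∤k q∤k (d∣k , d∣pq)
    with prime⇒irreducible q-prime (coprime-divisor (prime∤⇒coprime p-prime (λ p∣d → p∤k (∣-trans p∣d d∣k))) d∣pq)
  ... | inj₁ d≡1  = d≡1
  ... | inj₂ refl = contradiction d∣k q∤k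

module Arithmetic where

  open import Data.Nat using (ℕ; suc; _+_; _*_; _≤_; _<_; s≤s; z≤n)
  open import Data.Nat.Properties using (*-mono-≤; *-monoʳ-<; +-monoˡ-<; ≤-<-trans; m≤m+n; m<n+m; +-cancelˡ-≤)
  open import Data.Nat.Tactic.RingSolver using (solve-∀)
  open import Relation.Binary.PropositionalEquality using (_≡_; sym; trans; cong₂; subst; subst₂)

  -- The sum of the squared degrees of the four subgroup vertices, whose degrees are 1, a, b and a b.
  degSquares : ℕ → ℕ → ℕ
  degSquares a b = 1 + a * a + b * b + (a * b) * (a * b)

  3≤pred-square : ∀ {p a} → 1 < p → 1 + a ≡ p * p → 3 ≤ a
  3≤pred-square {p} {a} 1<p 1+a≡pp = +-cancelˡ-≤ 1 3 a (subst (4 ≤_) (sym 1+a≡pp) (*-mono-≤ 1<p 1<p))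

  [1+a][1+b]≤2ab : ∀ {a b} → 3 ≤ a → 3 ≤ b → (1 + a) * (1 + b) ≤ 2 * (a * b)
  [1+a][1+b]≤2ab {suc (suc (suc x))} {suc (suc (suc y))} (s≤s (s≤s (s≤s _))) (s≤s (s≤s (s≤s _))) =
    subst ((4 + x) * (4 + y) ≤_) (sym (gap x y)) (m≤m+n _ _)
    where
    gap : ∀ x y → 2 * ((3 + x) * (3 + y)) ≡ (4 + x) * (4 + y) + (2 + 2 * x + 2 * y + x * y)
    gap = solve-∀

  N²<4S : ∀ {a b} → 3 ≤ a → 3 ≤ b → ((1 + a) * (1 + b)) * ((1 + a) * (1 + b)) < 4 * degSquares a b
  N²<4S {a} {b} 3≤a 3≤b = ≤-<-trans N²≤4[ab]² (*-monoʳ-< 4 (m<n+m ((a * b) * (a * b)) (s≤s z≤n)))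
    where
    square-double : ∀ m → (2 * m) * (2 * m) ≡ 4 * (m * m)
    square-double = solve-∀
    N²≤4[ab]² : ((1 + a) * (1 + b)) * ((1 + a) * (1 + b)) ≤ 4 * ((a * b) * (a * b))
    N²≤4[ab]² = subst (((1 + a) * (1 + b)) * ((1 + a) * (1 + b)) ≤_) (square-double (a * b))
                      (*-mono-≤ ([1+a][1+b]≤2ab 3≤a 3≤b) ([1+a][1+b]≤2ab 3≤a 3≤b))

  -- M₁ |e| < M₂ |V| with M₁ = N + S, |e| = N, M₂ = S and |V| = N + 4.
  ratio-inequality : ∀ N S → N * N < 4 * S → (N + S) * N < S * (N + 4)
  ratio-inequality N S N²<4S = subst₂ _<_ (sym (lhs N S)) (sym (rhs N S)) (+-monoˡ-< (S * N) N²<4S)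
    where
    lhs : ∀ N S → (N + S) * N ≡ N * N + S * N
    lhs = solve-∀
    rhs : ∀ N S → S * (N + 4) ≡ 4 * S + S * N
    rhs = solve-∀

  sgb-inequality : ∀ {p q a b} → 1 < p → 1 < q → 1 + a ≡ p * p → 1 + b ≡ q * q →
    ((p * q) * (p * q) + degSquares a b) * ((p * q) * (p * q)) < degSquares a b * ((p * q) * (p * q) + 4)
  sgb-inequality {p} {q} {a} {b} 1<p 1<q a≡ b≡ = ratio-inequality ((p * q) * (p * q)) (degSquares a b)
    (subst (λ N → N * N < 4 * degSquares a b) N≡ (N²<4S (3≤pred-square 1<p a≡) (3≤pred-square 1<q b≡)))
    where
    interchange : ∀ p q → p * p * (q * q) ≡ p * q * (p * q)
    interchange = solve-∀
    N≡ : (1 + a) * (1 + b) ≡ (p * q) * (p * q)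
    N≡ = trans (cong₂ _*_ a≡ b≡) (interchange p q)

module IntegerFormulas where

  open import Data.Nat as ℕ using (ℕ)
  open import Data.Integer using (ℤ; +_; _+_; _-_; _*_; _^_)
  open import Data.Integer.Properties using (pos-*)
  open import Data.Integer.Solver using (module +-*-Solver)
  open import Relation.Binary.PropositionalEquality using (_≡_; refl; trans; cong; cong₂)
  open Arithmetic using (degSquares)
  open +-*-Solver

  M₁-rhs M₂-rhs : ℤ → ℤ → ℤ
  M₁-rhs P Q = (P ^ 4) * (Q ^ 4) - (+ 2) * (P ^ 4) * (Q ^ 2) - (+ 2) * (P ^ 2) * (Q ^ 4) + (+ 5) * (P ^ 2) * (Q ^ 2)
               + (+ 2) * (P ^ 4) + (+ 2) * (Q ^ 4) - (+ 4) * (P ^ 2) - (+ 4) * (Q ^ 2) + (+ 4)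
  M₂-rhs P Q = (P ^ 4) * (Q ^ 4) - (+ 2) * (P ^ 4) * (Q ^ 2) - (+ 2) * (P ^ 2) * (Q ^ 4) + (+ 4) * (P ^ 2) * (Q ^ 2)
               + (+ 2) * (P ^ 4) + (+ 2) * (Q ^ 4) - (+ 4) * (P ^ 2) - (+ 4) * (Q ^ 2) + (+ 4)

  M₁-polynomial : ∀ P Q A B → A ≡ P * P - + 1 → B ≡ Q * Q - + 1 →
                  (P * Q) * (P * Q) + (+ 1 + A * A + B * B + (A * B) * (A * B)) ≡ M₁-rhs P Q
  M₁-polynomial P Q _ _ refl refl = solve 2 (λ P Q →
    let A = P :* P :- con (+ 1)
        B = Q :* Q :- con (+ 1)
    in (P :* Q) :* (P :* Q) :+ (con (+ 1) :+ A :* A :+ B :* B :+ (A :* B) :* (A :* B))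
       := P :^ 4 :* Q :^ 4 :- con (+ 2) :* P :^ 4 :* Q :^ 2 :- con (+ 2) :* P :^ 2 :* Q :^ 4 :+ con (+ 5) :* P :^ 2 :* Q :^ 2
          :+ con (+ 2) :* P :^ 4 :+ con (+ 2) :* Q :^ 4 :- con (+ 4) :* P :^ 2 :- con (+ 4) :* Q :^ 2 :+ con (+ 4)) refl P Q

  M₂-polynomial : ∀ P Q A B → A ≡ P * P - + 1 → B ≡ Q * Q - + 1 →
                  + 1 + A * A + B * B + (A * B) * (A * B) ≡ M₂-rhs P Q
  M₂-polynomial P Q _ _ refl refl = solve 2 (λ P Q →
    let A = P :* P :- con (+ 1)
        B = Q :* Q :- con (+ 1)
    in con (+ 1) :+ A :* A :+ B :* B :+ (A :* B) :* (A :* B)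
       := P :^ 4 :* Q :^ 4 :- con (+ 2) :* P :^ 4 :* Q :^ 2 :- con (+ 2) :* P :^ 2 :* Q :^ 4 :+ con (+ 4) :* P :^ 2 :* Q :^ 2
          :+ con (+ 2) :* P :^ 4 :+ con (+ 2) :* Q :^ 4 :- con (+ 4) :* P :^ 2 :- con (+ 4) :* Q :^ 2 :+ con (+ 4)) refl P Q

  +-degSquares : ∀ a b → + degSquares a b ≡ + 1 + + a * + a + + b * + b + (+ a * + b) * (+ a * + b)
  +-degSquares a b = cong₂ _+_ (cong₂ _+_ (cong (_+_ (+ 1)) (pos-* a a)) (pos-* b b))
                               (trans (pos-* (a ℕ.* b) (a ℕ.* b)) (cong₂ _*_ (pos-* a b) (pos-* a b)))

  pos-pred-square : ∀ {p a} → 1 ℕ.+ a ≡ p ℕ.* p → + a ≡ + p * + p - + 1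
  pos-pred-square {p} {a} 1+a≡pp = trans (solve 1 (λ A → A := con (+ 1) :+ A :- con (+ 1)) refl (+ a))
                                        (cong (_- + 1) (trans (cong +_ 1+a≡pp) (pos-* p p)))

  M₁-formula : ∀ p q {a b} → 1 ℕ.+ a ≡ p ℕ.* p → 1 ℕ.+ b ≡ q ℕ.* q →
               + ((p ℕ.* q) ℕ.* (p ℕ.* q) ℕ.+ degSquares a b) ≡ M₁-rhs (+ p) (+ q)
  M₁-formula p q {a} {b} a≡ b≡ =
    trans (cong₂ _+_ (trans (pos-* (p ℕ.* q) (p ℕ.* q)) (cong₂ _*_ (pos-* p q) (pos-* p q))) (+-degSquares a b))
          (M₁-polynomial (+ p) (+ q) (+ a) (+ b) (pos-pred-square {p} a≡) (pos-pred-square {q} b≡))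

  M₂-formula : ∀ p q {a b} → 1 ℕ.+ a ≡ p ℕ.* p → 1 ℕ.+ b ≡ q ℕ.* q → + degSquares a b ≡ M₂-rhs (+ p) (+ q)
  M₂-formula p q {a} {b} a≡ b≡ =
    trans (+-degSquares a b) (M₂-polynomial (+ p) (+ q) (+ a) (+ b) (pos-pred-square {p} a≡) (pos-pred-square {q} b≡))

module CyclicGroupOfOrderPQ {p q : ℕ} (p-prime : Prime p) (q-prime : Prime q) (p≢q : p ≢ q)
  {_∙_ : Fin (p ℕ.* q) → Fin (p ℕ.* q) → Fin (p ℕ.* q)} {e : Fin (p ℕ.* q)} {inv : Fin (p ℕ.* q) → Fin (p ℕ.* q)}
  (isGroup : IsGroup _≡_ _∙_ e inv) (g : Fin (p ℕ.* q)) (generated : ∀ x → ∃ λ k → x ≡ pow _∙_ e g k) where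

  open import Data.Bool using (Bool; true; false; T; not; _∧_; _∨_; if_then_else_)
  open import Data.Bool.Properties using (T-∧; T-∨; ∨-comm; ∧-identityʳ) renaming (_≟_ to _≟ᵇ_)
  open import Data.Fin using (toℕ)
  open import Data.Fin.Properties using (any?)
  open import Data.List using (List; []; _∷_)
  open import Data.Nat using (_*_; _+_; _<_; z<s; NonZero; >-nonZero⁻¹)
  open import Data.Nat.DivMod using (m<n⇒m%n≡m)
  open import Data.Nat.Divisibility
    using (_∣_; _∣?_; _∣0; 1∣_; divides; ∣-refl; ∣-trans; ∣-reflexive; m∣m*n; n∣m*n; ∣m⇒∣m*n; n∣m⇒m%n≡0)
  open import Data.Nat.Primality using (prime⇒nonZero)
  open import Data.Nat.Properties
    using (*-identityˡ; *-identityʳ; +-identityʳ; +-cancelˡ-≡; *-comm; <-trans; *-monoʳ-<; *-monoˡ-<; +-0-commutativeMonoid)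
  open import Algebra.Properties.CommutativeMonoid.Sum +-0-commutativeMonoid using (sum-syntax)
  open import Data.Nat.Tactic.RingSolver using (solve-∀)
  open import Data.Product using (_×_; _,_; proj₁)
  open import Data.Product.Properties using (≡-dec)
  open import Data.Sum using (inj₁; inj₂)
  open import Data.Unit using (tt)
  open import Data.Vec using (tabulate)
  open import Data.Vec.Properties using (lookup∘tabulate)
  open import Function using (_⇔_; mk⇔; Equivalence)
  open import Relation.Binary.Definitions using (DecidableEquality)
  open import Relation.Binary.PropositionalEquality using (refl; sym; trans; cong; cong₂; subst; module ≡-Reasoning)
  open import Relation.Nullary using (¬_)
  open import Relation.Nullary.Decidable using (Dec; yes; no; does; dec-true; dec-false; does-⇔; _×-dec_; ¬?; T?; decidable-stable)
  open Booleans
  open ListSums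
  open FinSums using (∑-multiples)
  open Subsets using (_≟ˢ_; ∑-allSubsets-≟)
  open Primes
  open Arithmetic using (degSquares)
  open SubgroupGraph _∙_ e inv
  open CyclicGroup isGroup g generated
  open import Algebra.Properties.Group group using (\\-leftDividesʳ; //-rightDividesʳ)
  open Equivalence

  private
    n : ℕ
    n = p * q

    instance
      p-nonZero : NonZero p
      p-nonZero = prime⇒nonZero p-prime
      q-nonZero : NonZero q
      q-nonZero = prime⇒nonZero q-prime

    1<p : 1 < p
    1<p = prime>1 p-prime

    1<q : 1 < q
    1<q = prime>1 q-prime

    p<n : p < n
    p<n = subst (_< p * q) (*-identityʳ p) (*-monoʳ-< p 1<q)

    q<n : q < n
    q<n = subst (_< p * q) (*-identityˡ q) (*-monoˡ-< q 1<p)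

    p∣n : p ∣ n
    p∣n = m∣m*n q

    q∣n : q ∣ n
    q∣n = n∣m*n p

  -- (i , j) encodes the subgroup of order pⁱqʲ.
  member : Bool × Bool → Fin n → Bool
  member (i , j) x = (i ∨ does (p ∣? log x)) ∧ (j ∨ does (q ∣? log x))

  subgroup : Bool × Bool → Subset n
  subgroup c = tabulate (member c)

  ∈subgroup⇔ : ∀ c x → x ∈ subgroup c ⇔ T (member c x)
  ∈subgroup⇔ c x = mk⇔ (subst T (lookup∘tabulate (member c) x)) (subst T (sym (lookup∘tabulate (member c) x)))

  ∨∣-e : ∀ {d} i → T (i ∨ does (d ∣? log e))
  ∨∣-e     true  = tt
  ∨∣-e {d} false = from (T-does (d ∣? log e)) (subst (d ∣_) (sym log-e) (d ∣0))

  module _ {d} (d∣n : d ∣ n) where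

    ∨∣-∙ : ∀ i {x y} → T (i ∨ does (d ∣? log x)) → T (i ∨ does (d ∣? log y)) → T (i ∨ does (d ∣? log (x ∙ y)))
    ∨∣-∙ true  _   _   = tt
    ∨∣-∙ false d∣x d∣y = from (T-does (d ∣? _)) (∣log-∙ d∣n (to (T-does (d ∣? _)) d∣x) (to (T-does (d ∣? _)) d∣y))

    ∨∣-inv : ∀ i {x} → T (i ∨ does (d ∣? log x)) → T (i ∨ does (d ∣? log (inv x)))
    ∨∣-inv true  _   = tt
    ∨∣-inv false d∣x = from (T-does (d ∣? _)) (∣log-inv d∣n (to (T-does (d ∣? _)) d∣x))

  subgroup-isSubgroup : ∀ c → IsSubgroup (subgroup c)
  subgroup-isSubgroup (i , j) = record
    { e∈         = from (∈subgroup⇔ (i , j) e) (from T-∧ (∨∣-e {p} i , ∨∣-e {q} j))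
    ; ∙-closed   = λ {x} {y} x∈ y∈ →
        let x∈p , x∈q = to (T-∧ {i ∨ _}) (to (∈subgroup⇔ (i , j) x) x∈)
            y∈p , y∈q = to (T-∧ {i ∨ _}) (to (∈subgroup⇔ (i , j) y) y∈)
        in from (∈subgroup⇔ (i , j) (x ∙ y)) (from T-∧ (∨∣-∙ p∣n i x∈p y∈p , ∨∣-∙ q∣n j x∈q y∈q))
    ; inv-closed = λ {x} x∈ →
        let x∈p , x∈q = to (T-∧ {i ∨ _}) (to (∈subgroup⇔ (i , j) x) x∈)
        in from (∈subgroup⇔ (i , j) (inv x)) (from T-∧ (∨∣-inv p∣n i x∈p , ∨∣-inv q∣n j x∈q))
    }

  _≼_ : Bool × Bool → Bool × Bool → Bool
  (i′ , j′) ≼ (i , j) = (i′ ⇒ᵇ i) ∧ (j′ ⇒ᵇ j)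

  ≼-refl : ∀ c → T (c ≼ c)
  ≼-refl (i , j) = from T-∧ (⇒ᵇ-refl i , ⇒ᵇ-refl j)

  ≼-antisym : ∀ {c d} → T (c ≼ d) → T (d ≼ c) → c ≡ d
  ≼-antisym {i , j} {i′ , j′} c≼d d≼c =
    let i⇒i′ , j⇒j′ = to (T-∧ {i ⇒ᵇ i′}) c≼d
        i′⇒i , j′⇒j = to (T-∧ {i′ ⇒ᵇ i}) d≼c
    in cong₂ _,_ (⇒ᵇ-antisym i⇒i′ i′⇒i) (⇒ᵇ-antisym j⇒j′ j′⇒j)

  ≼-member : ∀ {d c} x → T (d ≼ c) → T (member d x) → T (member c x)
  ≼-member {i′ , j′} {i , j} x d≼c x∈ =
    let i′⇒i , j′⇒j = to (T-∧ {i′ ⇒ᵇ i}) d≼c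
        x∈p , x∈q   = to (T-∧ {i′ ∨ _}) x∈
    in from T-∧ (⇒ᵇ-∨ {i′} {i} _ i′⇒i x∈p , ⇒ᵇ-∨ {j′} {j} _ j′⇒j x∈q)

  generatorLog : Bool × Bool → ℕ
  generatorLog (true  , true)  = 1
  generatorLog (true  , false) = q
  generatorLog (false , true)  = p
  generatorLog (false , false) = 0

  generatorLog<n : ∀ c → generatorLog c < n
  generatorLog<n (true  , true)  = <-trans 1<p p<n
  generatorLog<n (true  , false) = q<n
  generatorLog<n (false , true)  = p<n
  generatorLog<n (false , false) = <-trans z<s (<-trans 1<p p<n)

  p∣generatorLog : ∀ i j → does (p ∣? generatorLog (i , j)) ≡ not i
  p∣generatorLog true  true  = dec-false (p ∣? 1) (prime∤1 p-prime)
  p∣generatorLog true  false = dec-false (p ∣? q) (prime∤prime p-prime q-prime p≢q)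
  p∣generatorLog false true  = dec-true (p ∣? p) ∣-refl
  p∣generatorLog false false = dec-true (p ∣? 0) (p ∣0)

  q∣generatorLog : ∀ i j → does (q ∣? generatorLog (i , j)) ≡ not j
  q∣generatorLog true  true  = dec-false (q ∣? 1) (prime∤1 q-prime)
  q∣generatorLog true  false = dec-true (q ∣? q) ∣-refl
  q∣generatorLog false true  = dec-false (q ∣? p) (prime∤prime q-prime p-prime (λ q≡p → p≢q (sym q≡p)))
  q∣generatorLog false false = dec-true (q ∣? 0) (q ∣0)

  generator : Bool × Bool → Fin n
  generator c = g ^ generatorLog c

  member-generator : ∀ c d → member c (generator d) ≡ d ≼ c
  member-generator (i , j) (i′ , j′) = cong₂ _∧_
    (trans (cong (λ k → i ∨ does (p ∣? k)) log-generator) (trans (cong (i ∨_) (p∣generatorLog i′ j′)) (∨-comm i (not i′))))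
    (trans (cong (λ k → j ∨ does (q ∣? k)) log-generator) (trans (cong (j ∨_) (q∣generatorLog i′ j′)) (∨-comm j (not j′))))
    where
    log-generator : log (generator (i′ , j′)) ≡ generatorLog (i′ , j′)
    log-generator = log-^< (generatorLog<n (i′ , j′))

  subgroup-⊆ᵇ : ∀ d c → (subgroup d ⊆ᵇ subgroup c) ≡ d ≼ c
  subgroup-⊆ᵇ d c = T-injective
    (λ t → subst T (member-generator c d) (to (∈subgroup⇔ c (generator d)) (to (⊆ᵇ⇔ {subgroup d} {subgroup c}) t (generator d) generator∈)))
    (λ d≼c → from (⊆ᵇ⇔ {subgroup d} {subgroup c}) λ x x∈ → from (∈subgroup⇔ c x) (≼-member {d} {c} x d≼c (to (∈subgroup⇔ d x) x∈)))
    where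
    generator∈ : generator d ∈ subgroup d
    generator∈ = from (∈subgroup⇔ d (generator d)) (subst T (sym (member-generator d d)) (≼-refl d))

  subgroup-injective : ∀ {c d} → subgroup c ≡ subgroup d → c ≡ d
  subgroup-injective {c} {d} eq = ≼-antisym (subst T (subgroup-⊆ᵇ c d) (⊆ᵇ-from eq)) (subst T (subgroup-⊆ᵇ d c) (⊆ᵇ-from (sym eq)))
    where
    ⊆ᵇ-from : ∀ {H K} → H ≡ K → T (H ⊆ᵇ K)
    ⊆ᵇ-from {H} {K} refl = from (⊆ᵇ⇔ {H} {H}) (λ _ x∈ → x∈)

  NonMultiple : ℕ → Subset n → Fin n → Set
  NonMultiple r K x = x ∈ K × ¬ r ∣ log x

  nonMultiple? : ∀ r K → Dec (∃ (NonMultiple r K))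
  nonMultiple? r K = any? (λ x → T? (x ∈ᵇ K) ×-dec ¬? (r ∣? log x))

  -- A subgroup is determined by whether its elements' logarithms are all multiples of p, resp. q.
  codeOf : Subset n → Bool × Bool
  codeOf K = does (nonMultiple? p K) , does (nonMultiple? q K)

  module _ {K : Subset n} (K-sub : IsSubgroup K) where
    open IsSubgroup K-sub

    ∈⇒member-codeOf : ∀ x → x ∈ K → T (member (codeOf K) x)
    ∈⇒member-codeOf x x∈ = from T-∧ (∨-nonMultiple p , ∨-nonMultiple q)
      where
      ∨-nonMultiple : ∀ r → T (does (nonMultiple? r K) ∨ does (r ∣? log x))
      ∨-nonMultiple r with r ∣? log x
      ... | yes _  = from (T-∨ {does (nonMultiple? r K)}) (inj₂ tt)
      ... | no r∤x = from T-∨ (inj₁ (from (T-does (nonMultiple? r K)) (x , x∈ , r∤x)))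

    coprime-element : ∃ (NonMultiple p K) → ∃ (NonMultiple q K) → ∃ λ w → w ∈ K × ¬ p ∣ log w × ¬ q ∣ log w
    coprime-element (y , y∈ , p∤y) (z , z∈ , q∤z) with q ∣? log y | p ∣? log z
    ... | no q∤y  | _       = y , y∈ , p∤y , q∤y
    ... | yes _   | no p∤z  = z , z∈ , p∤z , q∤z
    ... | yes q∣y | yes p∣z = y ∙ z , ∙-closed y∈ z∈ , p∤yz , q∤yz
      where
      p∤yz : ¬ p ∣ log (y ∙ z)
      p∤yz p∣yz = p∤y (subst (λ w → p ∣ log w) (//-rightDividesʳ z y) (∣log-∙ p∣n p∣yz (∣log-inv p∣n p∣z)))
      q∤yz : ¬ q ∣ log (y ∙ z)
      q∤yz q∣yz = q∤z (subst (λ w → q ∣ log w) (\\-leftDividesʳ y z) (∣log-∙ q∣n (∣log-inv q∣n q∣y) q∣yz))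

    multiples-of-∈ : ∀ {r s y x} → Prime r → n ∣ s * r → y ∈ K → ¬ r ∣ log y → s ∣ log y → s ∣ log x → x ∈ K
    multiples-of-∈ {r} {s} r-prime n∣sr y∈ r∤y (divides j log-y≡js) s∣x =
      multiples-∈ K-sub y∈ (trans log-y≡js (*-comm j s)) (prime∤⇒coprime r-prime r∤j) n∣sr s∣x
      where
      r∤j : ¬ r ∣ j
      r∤j r∣j = r∤y (subst (r ∣_) (sym log-y≡js) (∣m⇒∣m*n s r∣j))

    member-codeOf⇒∈ : ∀ x → T (member (codeOf K) x) → x ∈ K
    member-codeOf⇒∈ x = fill (nonMultiple? p K) (nonMultiple? q K)
      where
      fill : (P? : Dec (∃ (NonMultiple p K))) (Q? : Dec (∃ (NonMultiple q K))) → T (member (does P? , does Q?) x) → x ∈ K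
      fill (yes P) (yes Q) _ =
        let w , w∈ , p∤w , q∤w = coprime-element P Q
        in multiples-∈ K-sub w∈ (sym (*-identityˡ (log w))) (∤∧∤⇒coprime p-prime q-prime p∤w q∤w) (n∣m*n 1) (1∣ log x)
      fill (yes (y , y∈ , p∤y)) (no ∄Q) q∣x =
        multiples-of-∈ p-prime (∣-reflexive (*-comm p q)) y∈ p∤y
          (decidable-stable (q ∣? log y) (λ q∤y → ∄Q (y , y∈ , q∤y))) (to (T-does (q ∣? log x)) q∣x)
      fill (no ∄P) (yes (z , z∈ , q∤z)) p∣x =
        multiples-of-∈ q-prime ∣-refl z∈ q∤z
          (decidable-stable (p ∣? log z) (λ p∤z → ∄P (z , z∈ , p∤z)))
          (to (T-does (p ∣? log x)) (proj₁ (to (T-∧ {does (p ∣? log x)}) p∣x)))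
      fill (no _) (no _) pq∣x =
        let p∣x , q∣x = to (T-∧ {does (p ∣? log x)}) pq∣x
            n∣x = ∣∧∣⇒*∣ p-prime q-prime p≢q (to (T-does (p ∣? _)) p∣x) (to (T-does (q ∣? _)) q∣x)
            log-x≡0 = trans (sym (m<n⇒m%n≡m (log<n x))) (n∣m⇒m%n≡0 (log x) n n∣x)
        in subst (_∈ K) (trans (cong (g ^_) (sym log-x≡0)) (^-log x)) e∈

    classify : K ≡ subgroup (codeOf K)
    classify = ⊆-antisym (λ x x∈ → from (∈subgroup⇔ (codeOf K) x) (∈⇒member-codeOf x x∈))
                         (λ x x∈ → member-codeOf⇒∈ x (to (∈subgroup⇔ (codeOf K) x) x∈))

  codes : List (Bool × Bool)
  codes = (false , false) ∷ (true , false) ∷ (false , true) ∷ (true , true) ∷ []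

  _≟ᶜ_ : DecidableEquality (Bool × Bool)
  _≟ᶜ_ = ≡-dec _≟ᵇ_ _≟ᵇ_

  ∑-codes-≟ : ∀ c m → ∑ codes (λ d → if does (c ≟ᶜ d) then m else 0) ≡ m
  ∑-codes-≟ (false , false) m = +-identityʳ m
  ∑-codes-≟ (true  , false) m = +-identityʳ m
  ∑-codes-≟ (false , true)  m = +-identityʳ m
  ∑-codes-≟ (true  , true)  m = +-identityʳ m

  ∑-L≡∑-codes : ∀ f → ∑ L f ≡ ∑ codes (λ c → f (subgroup c))
  ∑-L≡∑-codes f = begin
    ∑ L f                                                     ≡⟨ ∑-L f ⟩
    ∑ (allSubsets n) (λ S → if isSubgroup S then f S else 0)  ≡⟨ ∑-cong (allSubsets n) split ⟩
    ∑ (allSubsets n) (λ S → ∑ codes (restrict S))             ≡⟨ ∑-comm (allSubsets n) codes restrict ⟩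
    ∑ codes (λ c → ∑ (allSubsets n) (λ S → restrict S c))     ≡⟨ ∑-cong codes (λ c → ∑-allSubsets-≟ (subgroup c) f) ⟩
    ∑ codes (λ c → f (subgroup c))                            ∎
    where
    open ≡-Reasoning
    restrict : Subset n → Bool × Bool → ℕ
    restrict S c = if does (S ≟ˢ subgroup c) then f S else 0
    split : ∀ S → (if isSubgroup S then f S else 0) ≡ ∑ codes (restrict S)
    split S with isSubgroup S in eq
    ... | true  = sym (trans (∑-cong codes λ c → cong (λ b → if b then f S else 0) (does-⇔ S≡subgroup⇔ (S ≟ˢ subgroup c) (codeOf S ≟ᶜ c)))
                             (∑-codes-≟ (codeOf S) (f S)))
      where
      S≡subgroup : S ≡ subgroup (codeOf S)
      S≡subgroup = classify (to isSubgroup⇔ (subst T (sym eq) tt))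
      S≡subgroup⇔ : ∀ {c} → S ≡ subgroup c ⇔ codeOf S ≡ c
      S≡subgroup⇔ = mk⇔ (λ S≡subc → subgroup-injective (trans (sym S≡subgroup) S≡subc))
                        (λ codeOf≡c → trans S≡subgroup (cong subgroup codeOf≡c))
    ... | false = sym (trans (∑-cong codes λ c → cong (λ b → if b then f S else 0) (dec-false (S ≟ˢ subgroup c) (S≢subgroup c)))
                             (∑-zero codes))
      where
      S≢subgroup : ∀ c → ¬ S ≡ subgroup c
      S≢subgroup c S≡subc = subst T (trans (cong isSubgroup (sym S≡subc)) eq) (from isSubgroup⇔ (subgroup-isSubgroup c))

  orderOf : Bool × Bool → ℕ
  orderOf (i , j) = (if i then p else 1) * (if j then q else 1)

  ∑-divisible : ∀ d → ∑ elems (λ x → [ does (d ∣? log x) ]) ≡ ∑[ k < n ] [ does (d ∣? toℕ k) ]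
  ∑-divisible d = ∑-log (λ k → [ does (d ∣? k) ])

  order-subgroup : ∀ c → order (subgroup c) ≡ orderOf c
  order-subgroup c = trans (∑-cong elems (λ x → cong [_] (lookup∘tabulate (member c) x))) (counted c)
    where
    counted : ∀ c → ∑ elems (λ x → [ member c x ]) ≡ orderOf c
    counted (true , true) = ∑-elems-1
    counted (true , false) = begin
      ∑ elems (λ x → [ does (q ∣? log x) ])  ≡⟨ ∑-divisible q ⟩
      ∑[ k < p * q ] [ does (q ∣? toℕ k) ]    ≡⟨ ∑-multiples p (>-nonZero⁻¹ q) ⟩
      p                                       ≡⟨ *-identityʳ p ⟨
      p * 1                                   ∎
      where open ≡-Reasoning
    counted (false , true) = begin
      ∑ elems (λ x → [ does (p ∣? log x) ∧ true ])  ≡⟨ ∑-cong elems (λ x → cong [_] (∧-identityʳ _)) ⟩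
      ∑ elems (λ x → [ does (p ∣? log x) ])         ≡⟨ ∑-divisible p ⟩
      ∑[ k < p * q ] [ does (p ∣? toℕ k) ]           ≡⟨ cong (λ m → ∑[ k < m ] [ does (p ∣? toℕ k) ]) (*-comm p q) ⟩
      ∑[ k < q * p ] [ does (p ∣? toℕ k) ]           ≡⟨ ∑-multiples q (>-nonZero⁻¹ p) ⟩
      q                                              ≡⟨ *-identityˡ q ⟨
      1 * q                                          ∎
      where open ≡-Reasoning
    counted (false , false) = begin
      ∑ elems (λ x → [ does (p ∣? log x) ∧ does (q ∣? log x) ])
        ≡⟨ ∑-cong elems (λ x → cong [_] (does-⇔ pq∣⇔ (p ∣? log x ×-dec q ∣? log x) (n ∣? log x))) ⟩
      ∑ elems (λ x → [ does (n ∣? log x) ])                      ≡⟨ ∑-divisible n ⟩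
      ∑[ k < n ] [ does (n ∣? toℕ k) ]                            ≡⟨ cong (λ m → ∑[ k < m ] [ does (n ∣? toℕ k) ]) (*-identityˡ n) ⟨
      ∑[ k < 1 * n ] [ does (n ∣? toℕ k) ]                        ≡⟨ ∑-multiples 1 (>-nonZero⁻¹ n) ⟩
      1                                                          ∎
      where
      open ≡-Reasoning
      pq∣⇔ : ∀ {k} → (p ∣ k × q ∣ k) ⇔ n ∣ k
      pq∣⇔ = mk⇔ (λ (p∣k , q∣k) → ∣∧∣⇒*∣ p-prime q-prime p≢q p∣k q∣k) (λ n∣k → ∣-trans p∣n n∣k , ∣-trans q∣n n∣k)

  deg : Bool × Bool → ℕ
  deg c = degSub (subgroup c)

  ∑-deg-≼ : ∀ c → ∑ codes (λ d → [ d ≼ c ] * deg d) ≡ orderOf c * orderOf c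
  ∑-deg-≼ c = begin
    ∑ codes (λ d → [ d ≼ c ] * deg d)           ≡⟨ ∑-cong codes (λ d → cong (λ b → [ b ] * deg d) (subgroup-⊆ᵇ d c)) ⟨
    ∑ codes (λ d → [ subgroup d ⊆ᵇ subgroup c ] * deg d)  ≡⟨ ∑-L≡∑-codes (λ H → [ H ⊆ᵇ subgroup c ] * degSub H) ⟨
    ∑ L (λ H → [ H ⊆ᵇ subgroup c ] * degSub H)       ≡⟨ ∑-degSub-⊆ (subgroup-isSubgroup c) ⟩
    order (subgroup c) * order (subgroup c)               ≡⟨ cong₂ _*_ (order-subgroup c) (order-subgroup c) ⟩
    orderOf c * orderOf c                       ∎
    where open ≡-Reasoning

  deg-E : deg (false , false) ≡ 1
  deg-E = trans (sym (trans (+-identityʳ _) (+-identityʳ _))) (∑-deg-≼ (false , false))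

  deg-P : 1 + deg (true , false) ≡ p * p
  deg-P = trans (cong (λ d → d + deg (true , false)) (sym deg-E))
                (trans (tidy (deg (false , false)) (deg (true , false))) (trans (∑-deg-≼ (true , false)) (cong₂ _*_ (*-identityʳ p) (*-identityʳ p))))
    where
    tidy : ∀ e a → e + a ≡ e + 0 + (a + 0 + 0)
    tidy = solve-∀

  deg-Q : 1 + deg (false , true) ≡ q * q
  deg-Q = trans (cong (λ d → d + deg (false , true)) (sym deg-E))
                (trans (tidy (deg (false , false)) (deg (false , true))) (trans (∑-deg-≼ (false , true)) (cong₂ _*_ (+-identityʳ q) (+-identityʳ q))))
    where
    tidy : ∀ e b → e + b ≡ e + 0 + (b + 0 + 0)
    tidy = solve-∀

  deg-G : deg (true , true) ≡ deg (true , false) * deg (false , true)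
  deg-G = +-cancelˡ-≡ (1 + a + b) _ _ (begin
    1 + a + b + deg (true , true)                             ≡⟨ cong (λ d → d + a + b + deg (true , true)) deg-E ⟨
    deg (false , false) + a + b + deg (true , true)           ≡⟨ tidy (deg (false , false)) a b (deg (true , true)) ⟩
    deg (false , false) + 0 + (a + 0 + (b + 0 + (deg (true , true) + 0 + 0))) ≡⟨ ∑-deg-≼ (true , true) ⟩
    p * q * (p * q)                                           ≡⟨ interchange p q ⟩
    p * p * (q * q)                                           ≡⟨ cong₂ _*_ deg-P deg-Q ⟨
    (1 + a) * (1 + b)                                         ≡⟨ expand a b ⟩
    1 + a + b + a * b                                         ∎)
    where
    open ≡-Reasoning
    a = deg (true , false)
    b = deg (false , true)
    tidy : ∀ e a b t → e + a + b + t ≡ e + 0 + (a + 0 + (b + 0 + (t + 0 + 0)))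
    tidy = solve-∀
    interchange : ∀ p q → p * q * (p * q) ≡ p * p * (q * q)
    interchange = solve-∀
    expand : ∀ a b → (1 + a) * (1 + b) ≡ 1 + a + b + a * b
    expand = solve-∀

  ∑-degSub² : ∑ L (λ H → degSub H * degSub H) ≡ degSquares (deg (true , false)) (deg (false , true))
  ∑-degSub² = begin
    ∑ L (λ H → degSub H * degSub H)                                                   ≡⟨ ∑-L≡∑-codes _ ⟩
    deg (false , false) * deg (false , false) + (a * a + (b * b + (deg (true , true) * deg (true , true) + 0)))
                                                                                    ≡⟨ cong₂ (λ e t → e * e + (a * a + (b * b + (t * t + 0)))) deg-E deg-G ⟩
    1 * 1 + (a * a + (b * b + ((a * b) * (a * b) + 0)))                               ≡⟨ tidy a b ⟩
    degSquares a b                                                                  ∎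
    where
    open ≡-Reasoning
    a = deg (true , false)
    b = deg (false , true)
    tidy : ∀ a b → 1 * 1 + (a * a + (b * b + ((a * b) * (a * b) + 0))) ≡ 1 + a * a + b * b + (a * b) * (a * b)
    tidy = solve-∀

  M₁-cyclic : M₁ ≡ (p * q) * (p * q) + degSquares (deg (true , false)) (deg (false , true))
  M₁-cyclic = trans M₁≡ (cong ((p * q) * (p * q) +_) ∑-degSub²)

  M₂-cyclic : M₂ ≡ degSquares (deg (true , false)) (deg (false , true))
  M₂-cyclic = trans M₂≡ ∑-degSub²

  numVertices-cyclic : numVertices ≡ (p * q) * (p * q) + 4
  numVertices-cyclic = trans numVertices≡ (cong ((p * q) * (p * q) +_) (trans (sym (∑-length L)) (∑-L≡∑-codes (λ _ → 1))))

open import Data.Nat using (ℕ; _*_; _<_)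
open import Data.Nat.Primality using (Prime)
open import Data.Integer using (ℤ; +_; _-_; _+_; _^_)
open import Data.Fin using (Fin)
open import Data.Product using (_×_)
open import Relation.Binary.PropositionalEquality using (_≡_)
open import Algebra.Structures using (IsGroup)
open import Data.Product using (_,_)
open import Data.Nat.Properties using (<⇒≢)
open import Relation.Binary.PropositionalEquality using (sym; trans; cong; cong₂; subst₂)

mainTheorem4 : (p q : ℕ) → Prime p → Prime q → p < q →
  (_∙_ : Fin (p * q) → Fin (p * q) → Fin (p * q)) (e : Fin (p * q)) (inv : Fin (p * q) → Fin (p * q)) →
  IsGroup _≡_ _∙_ e inv → IsCyclic _∙_ e →
  let open SGB _∙_ e inv
      P = + p
      Q = + q
  in ((+ M₁) ≡ (P ^ 4) Data.Integer.* (Q ^ 4) - (+ 2) Data.Integer.* (P ^ 4) Data.Integer.* (Q ^ 2) - (+ 2) Data.Integer.* (P ^ 2) Data.Integer.* (Q ^ 4) + (+ 5) Data.Integer.* (P ^ 2) Data.Integer.* (Q ^ 2) + (+ 2) Data.Integer.* (P ^ 4) + (+ 2) Data.Integer.* (Q ^ 4) - (+ 4) Data.Integer.* (P ^ 2) - (+ 4) Data.Integer.* (Q ^ 2) + (+ 4))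
   × ((+ M₂) ≡ (P ^ 4) Data.Integer.* (Q ^ 4) - (+ 2) Data.Integer.* (P ^ 4) Data.Integer.* (Q ^ 2) - (+ 2) Data.Integer.* (P ^ 2) Data.Integer.* (Q ^ 4) + (+ 4) Data.Integer.* (P ^ 2) Data.Integer.* (Q ^ 2) + (+ 2) Data.Integer.* (P ^ 4) + (+ 2) Data.Integer.* (Q ^ 4) - (+ 4) Data.Integer.* (P ^ 2) - (+ 4) Data.Integer.* (Q ^ 2) + (+ 4))
   × (M₁ * numEdges < M₂ * numVertices)
mainTheorem4 p q p-prime q-prime p<q _∙_ e inv isGroup (g , generated) =
    trans (cong +_ M₁-cyclic) (M₁-formula p q deg-P deg-Q)
  , trans (cong +_ M₂-cyclic) (M₂-formula p q deg-P deg-Q)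
  , subst₂ _<_ (sym (cong₂ _*_ M₁-cyclic numEdges≡)) (sym (cong₂ _*_ M₂-cyclic numVertices-cyclic))
      (sgb-inequality (prime>1 p-prime) (prime>1 q-prime) deg-P deg-Q)
  where
  open CyclicGroupOfOrderPQ p-prime q-prime (<⇒≢ p<q) isGroup g generated
  open SubgroupGraph _∙_ e inv using (numEdges≡)
  open Primes using (prime>1)
  open Arithmetic using (sgb-inequality)
  open IntegerFormulas using (M₁-formula; M₂-formula)
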